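{- Let $d\ge1$ and let $\mathcal{G}_d$ be an infinite subfamily of $\mathcal{X}_d$. Assume that for each $X_{f,q}\in\mathcal{G}_d$ there is a subset $B\subset\mathbb{F}_q$ with $|B|=O(1)$ such that the $(u,v)$ entry of $A(X_{f,q})^2$ is $q/4+O(1)$ for all $u,v\in\mathbb{F}_q\setminus B$ with $u\ne v$ (the implied constants uniform over the family). Then $\mathcal{G}_d$ is a family of quasi-random graphs with property $QR(1/2)$.
   Context: $q$ is an odd prime power; an element of $\mathbb{F}_q$ is a square if it equals $z^2$ for some $z$ (so $0$ is a square). For $f\in\mathbb{F}_q[x,y]$, $X_{f,q}$ is the simple graph on $\mathbb{F}_q$ in which distinct $a,b$ are adjacent iff $f(a,b)$ is a square; $A(X)$ is the adjacency matrix. Write $f=F(x)G(y)H(x,y)$ with $H$ primitive in both $x$ and $y$ (no nonconstant factor in $\mathbb{F}_q[x]$ or $\mathbb{F}_q[y]$). $f$ is admissible if (i) $f(u,v)$ is a square iff $f(v,u)$ is, for all $u,v$, and (ii) $H$ is not a constant multiple of a square of a polynomial. $\mathcal{X}_d$ is the family of all $X_{f,q}$ with $q$ an odd prime power and $f$ admissible of degree $d$. $e(S,T)$ is the number of pairs $(s,t)\in S\times T$ with $s,t$ adjacent. A family with unbounded numbers of vertices has property $QR(\theta)$ if there is $c>0$ with $|e(S,T)-|S||T|/2|\le cn^\theta\sqrt{|S||T|}$ for all its graphs ($n$ vertices) and all vertex subsets $S,T$. -}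

module Defs where

open import Data.Nat as ℕ using (ℕ; zero; suc; _∸_; _%_; _<_; _≤_)
open import Data.Nat.Primality using (Prime)
open import Data.Integer as ℤ using (ℤ; +_; ∣_∣)
open import Data.Fin as Fin using (Fin)
open import Data.Fin.Properties using (any?)
open import Data.Fin.Subset using (Subset; _∉_)
open import Data.Vec using (lookup)
open import Data.Bool using (Bool; true; false; if_then_else_; _∧_; not)
open import Data.Product using (Σ; ∃; ∃₂; _×_; _,_; proj₁; proj₂)
open import Relation.Nullary using (¬_; does)
open import Relation.Binary.PropositionalEquality using (_≡_; _≢_)
open import Algebra.Structures using (IsCommutativeRing)
open import Function.Bundles using (_⇔_)

-- A finite field of odd order q, with carrier Fin q and equality _≡_.
-- (Every finite field of order q is isomorphic to one of this form.)

record OddFiniteField : Set where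
  field
    q          : ℕ
    _+_ _*_    : Fin q → Fin q → Fin q
    -_         : Fin q → Fin q
    0# 1#      : Fin q
    isCommRing : IsCommutativeRing _≡_ _+_ _*_ -_ 0# 1#
    0≢1        : 0# ≢ 1#
    inverse    : ∀ a → a ≢ 0# → ∃ λ b → a * b ≡ 1#
    q-odd      : q % 2 ≡ 1
    q-primePow : ∃₂ λ p k → Prime p × q ≡ p ℕ.^ suc k

module _ (𝔽 : OddFiniteField) where
  open OddFiniteField 𝔽

  K : Set
  K = Fin q

  pow : K → ℕ → K
  pow a zero    = 1#
  pow a (suc n) = a * pow a n

  sumK : ℕ → (ℕ → K) → K
  sumK zero    g = 0#
  sumK (suc n) g = g zero + sumK n (λ i → g (suc i))

  -- squares (0 is a square)
  IsSquare : K → Set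
  IsSquare a = ∃ λ z → z * z ≡ a

  isSquare? : K → Bool
  isSquare? a = does (any? (λ z → (z * z) Fin.≟ a))

  -- Bivariate polynomials in F_q[x,y]: coefficient c i j of x^i y^j,
  -- vanishing whenever i + j exceeds some bound.

  Coeffs : Set
  Coeffs = ℕ → ℕ → K

  record Poly2 : Set where
    field
      bound  : ℕ
      coef   : Coeffs
      vanish : ∀ i j → bound < i ℕ.+ j → coef i j ≡ 0#
  open Poly2 public

  mulC : Coeffs → Coeffs → Coeffs
  mulC f g i j = sumK (suc i) λ a → sumK (suc j) λ b → f a b * g (i ∸ a) (j ∸ b)

  _≈C_ : Poly2 → Coeffs → Set
  f ≈C c = ∀ i j → coef f i j ≡ c i j

  eval : Poly2 → K → K → K
  eval f a b = sumK (suc (bound f)) λ i → sumK (suc (bound f)) λ j →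
                 coef f i j * (pow a i * pow b j)

  HasDegree : Poly2 → ℕ → Set
  HasDegree f d = (∃₂ λ i j → i ℕ.+ j ≡ d × coef f i j ≢ 0#)
                × (∀ i j → d < i ℕ.+ j → coef f i j ≡ 0#)

  InX : Poly2 → Set
  InX P = ∀ i j → j ≢ 0 → coef P i j ≡ 0#
  InY : Poly2 → Set
  InY P = ∀ i j → i ≢ 0 → coef P i j ≡ 0#

  Nonconstant : Poly2 → Set
  Nonconstant P = ∃₂ λ i j → 0 < i ℕ.+ j × coef P i j ≢ 0#

  _∣P_ : Poly2 → Poly2 → Set
  P ∣P H = ∃ λ (Q : Poly2) → H ≈C mulC (coef P) (coef Q)

  PrimitiveX : Poly2 → Set
  PrimitiveX H = ∀ P → InX P → Nonconstant P → ¬ (P ∣P H)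
  PrimitiveY : Poly2 → Set
  PrimitiveY H = ∀ P → InY P → Nonconstant P → ¬ (P ∣P H)

  ConstTimesSquare : Poly2 → Set
  ConstTimesSquare H = ∃₂ λ (c : K) (L : Poly2) →
    H ≈C (λ i j → c * mulC (coef L) (coef L) i j)

  Admissible : Poly2 → Set
  Admissible f =
      (∀ u v → IsSquare (eval f u v) ⇔ IsSquare (eval f v u))
    × (Σ Poly2 λ F → Σ Poly2 λ G → Σ Poly2 λ H →
         InX F × InY G × PrimitiveX H × PrimitiveY H
       × f ≈C mulC (mulC (coef F) (coef G)) (coef H)
       × ¬ ConstTimesSquare H)

  sumFin : ∀ {n} → (Fin n → ℕ) → ℕ
  sumFin {zero}  g = 0
  sumFin {suc n} g = g Fin.zero ℕ.+ sumFin (λ i → g (Fin.suc i))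

  adj : Poly2 → K → K → Bool
  adj f a b = not (does (a Fin.≟ b)) ∧ isSquare? (eval f a b)

  one? : Bool → ℕ
  one? b = if b then 1 else 0

  A² : Poly2 → K → K → ℕ
  A² f u v = sumFin λ w → one? (adj f u w ∧ adj f w v)

  edges : Poly2 → Subset q → Subset q → ℕ
  edges f S T = sumFin λ s → sumFin λ t →
                  one? (lookup S s ∧ lookup T t ∧ adj f s t)

record Member (d : ℕ) : Set where
  field
    field𝔽 : OddFiniteField
    poly   : Poly2 field𝔽
    adm    : Admissible field𝔽 poly
    deg    : HasDegree field𝔽 poly d

  order : ℕ
  order = OddFiniteField.q field𝔽

{-# OPTIONS --safe #-}
module Submission where

-- Let P = J - 2A be the ±1 matrix of the graph on V ∖ B. Up to the contribution of
-- the at most K exceptional vertices, |S||T| - 2e(S,T) is the bilinear form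
-- χ_S ∙ P χ_T, whose square is at most |S| ‖P χ_T‖² by Cauchy–Schwarz. The codegree
-- hypothesis says that P² = E + r 𝟏ᵀ + 𝟏 rᵀ, where r = P 𝟏 are the signed degrees and
-- E = 4A² - n is bounded off the diagonal; hence ‖P χ_T‖² = χ_T ∙ E χ_T + 2|T| (r ∙ χ_T)
-- is O(n |T|) as soon as ‖r‖² = O(n). That follows by computing ‖P r‖² = ‖P² 𝟏‖² in
-- two ways, which gives n³ ‖r‖² = O(n² ‖r‖² + n⁴), while trivially ‖r‖² ≤ n³.

open import Data.Bool using (Bool; true; false; not; _∧_)
open import Data.Empty using (⊥-elim)
open import Data.Fin as Fin using (Fin)
open import Data.Fin.Properties using (suc-injective; any?)
open import Data.Fin.Subset using (Subset; ∁; _∈_; _∉_) renaming (∣_∣ to ∣_∣ˢ)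
open import Data.Fin.Subset.Properties using (x∈∁p⇒x∉p)
open import Data.Integer as ℤ
  using (ℤ; +_; -[1+_]; ∣_∣; _+_; _*_; _-_; -_; 0ℤ; 1ℤ; -1ℤ; nonNegative; positive; _≤_; _<_; _≤?_; +≤+; -≤+)
open import Data.Integer.Properties hiding (abs-*)
open import Data.Integer.Tactic.RingSolver using (solve-∀)
open import Algebra.Properties.Semiring.Sum +-*-semiring
  using (sum; sum-syntax; sum-cong-≗; ∑-distrib-+; ∑-comm; *-distribˡ-sum; *-distribʳ-sum)
open import Data.Nat as ℕ using (ℕ; zero; suc; z≤n)
import Data.Nat.Properties as ℕ
open import Data.Product using (Σ; ∃; ∃₂; _×_; _,_; proj₁)
open import Data.Vec using (_∷_; []; lookup; here; there)
open import Data.Vec.Properties using (lookup-map)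
open import Function using (_∘_)
open import Function.Bundles using (_⇔_; mk⇔)
open import Relation.Binary.PropositionalEquality
  using (_≡_; _≢_; refl; sym; trans; cong; cong₂; subst; subst₂; module ≡-Reasoning)
open import Relation.Nullary using (does; yes; no)
open import Relation.Nullary.Decidable using (does-⇔)

open import Defs

private
  variable
    m n : ℕ

[_] : Bool → ℤ
[ true ]  = 1ℤ
[ false ] = 0ℤ

abs : ℤ → ℤ
abs i = + ∣ i ∣

Vec : ℕ → Set
Vec n = Fin n → ℤ

_∙_ : Vec n → Vec n → ℤ
u ∙ v = sum (λ i → u i * v i)

infix 8 _∙_

𝟏 : Vec n
𝟏 _ = 1ℤ

δ : Fin n → Fin n → ℤ
δ i j = [ does (i Fin.≟ j) ]

∑-const : ∀ n c → ∑[ i < n ] c ≡ + n * c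
∑-const zero    c = sym (*-zeroˡ c)
∑-const (suc n) c = trans (cong (λ x → c + x) (∑-const n c)) (lemma c (+ n))
  where
  lemma : ∀ c m → c + m * c ≡ (1ℤ + m) * c
  lemma = solve-∀

∑-zero : ∀ n → ∑[ i < n ] 0ℤ ≡ 0ℤ
∑-zero n = trans (∑-const n 0ℤ) (*-zeroʳ (+ n))

∑-neg : ∀ (f : Vec n) → ∑[ i < n ] (- f i) ≡ - sum f
∑-neg {n} f = begin
  ∑[ i < n ] (- f i)      ≡⟨ sum-cong-≗ (λ i → sym (-1*i≡-i (f i))) ⟩
  ∑[ i < n ] (-1ℤ * f i)  ≡⟨ *-distribˡ-sum -1ℤ f ⟨
  -1ℤ * sum f             ≡⟨ -1*i≡-i (sum f) ⟩
  - sum f                 ∎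
  where open ≡-Reasoning

∑-distrib-- : ∀ (f g : Vec n) → ∑[ i < n ] (f i - g i) ≡ sum f - sum g
∑-distrib-- f g = trans (∑-distrib-+ f (-_ ∘ g)) (cong (λ x → sum f + x) (∑-neg g))

∑-distrib-+₃ : ∀ (f g h : Vec n) → ∑[ i < n ] (f i + g i + h i) ≡ sum f + sum g + sum h
∑-distrib-+₃ f g h = trans (∑-distrib-+ (λ i → f i + g i) h) (cong (_+ sum h) (∑-distrib-+ f g))

∑-linear : ∀ a b c (f g h : Vec n) →
  ∑[ i < n ] (a * f i + b * g i + c * h i) ≡ a * sum f + b * sum g + c * sum h
∑-linear {n} a b c f g h = begin
  ∑[ i < n ] (a * f i + b * g i + c * h i)
    ≡⟨ trans (∑-distrib-+ (λ i → a * f i + b * g i) (λ i → c * h i))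
             (cong (λ x → x + ∑[ i < n ] (c * h i)) (∑-distrib-+ (λ i → a * f i) (λ i → b * g i))) ⟩
  ∑[ i < n ] (a * f i) + ∑[ i < n ] (b * g i) + ∑[ i < n ] (c * h i)
    ≡⟨ cong₂ _+_ (cong₂ _+_ (*-distribˡ-sum a f) (*-distribˡ-sum b g)) (*-distribˡ-sum c h) ⟨
  a * sum f + b * sum g + c * sum h ∎
  where open ≡-Reasoning

∑-sub-scaled : ∀ c (f g : Vec n) → ∑[ i < n ] (f i - c * g i) ≡ sum f - c * sum g
∑-sub-scaled c f g = trans (∑-distrib-- f (λ i → c * g i)) (cong (λ x → sum f - x) (sym (*-distribˡ-sum c g)))

∑-+-const : ∀ (w : Vec n) c → ∑[ i < n ] (w i + c) ≡ sum w + + n * c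
∑-+-const {n} w c = trans (∑-distrib-+ w (λ _ → c)) (cong (λ x → sum w + x) (∑-const n c))

∑-+-const-sq : ∀ (w : Vec n) c →
  ∑[ i < n ] ((w i + c) * (w i + c)) ≡ w ∙ w + + 2 * c * sum w + + n * (c * c)
∑-+-const-sq {n} w c = begin
  ∑[ i < n ] ((w i + c) * (w i + c))
    ≡⟨ sum-cong-≗ (λ i → expand (w i) c) ⟩
  ∑[ i < n ] (1ℤ * (w i * w i) + (+ 2 * c) * w i + (c * c) * 1ℤ)
    ≡⟨ ∑-linear 1ℤ (+ 2 * c) (c * c) (λ i → w i * w i) w 𝟏 ⟩
  1ℤ * (w ∙ w) + + 2 * c * sum w + c * c * sum (𝟏 {n})
    ≡⟨ cong₂ (λ x y → x + + 2 * c * sum w + c * c * y) (*-identityˡ (w ∙ w)) (∑-const n 1ℤ) ⟩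
  w ∙ w + + 2 * c * sum w + c * c * (+ n * 1ℤ)
    ≡⟨ cong (λ x → w ∙ w + + 2 * c * sum w + x) (reorder (c * c) (+ n)) ⟩
  w ∙ w + + 2 * c * sum w + + n * (c * c) ∎
  where
  open ≡-Reasoning
  expand : ∀ x c → (x + c) * (x + c) ≡ 1ℤ * (x * x) + (+ 2 * c) * x + (c * c) * 1ℤ
  expand = solve-∀
  reorder : ∀ a m → a * (m * 1ℤ) ≡ m * a
  reorder = solve-∀

∑-*-∑ : ∀ (f : Vec m) (g : Vec n) → sum f * sum g ≡ ∑[ i < m ] ∑[ j < n ] (f i * g j)
∑-*-∑ f g = trans (*-distribʳ-sum (sum g) f) (sum-cong-≗ (λ i → *-distribˡ-sum (f i) g))

∑-δ : ∀ (i : Fin n) (f : Vec n) → ∑[ j < n ] (δ i j * f j) ≡ f i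
∑-δ {suc n} Fin.zero f = begin
  1ℤ * f Fin.zero + ∑[ j < n ] (0ℤ * f (Fin.suc j))
    ≡⟨ cong₂ _+_ (*-identityˡ (f Fin.zero)) (sum-cong-≗ (λ j → *-zeroˡ (f (Fin.suc j)))) ⟩
  f Fin.zero + ∑[ j < n ] 0ℤ ≡⟨ cong (λ x → f Fin.zero + x) (∑-zero n) ⟩
  f Fin.zero + 0ℤ ≡⟨ +-identityʳ _ ⟩
  f Fin.zero ∎
  where open ≡-Reasoning
∑-δ {suc n} (Fin.suc i) f = begin
  δ (Fin.suc i) Fin.zero * f Fin.zero + ∑[ j < n ] (δ (Fin.suc i) (Fin.suc j) * f (Fin.suc j))
    ≡⟨ cong₂ _+_ (*-zeroˡ (f Fin.zero)) (sum-cong-≗ (λ j → cong (λ b → [ b ] * f (Fin.suc j)) (suc-≟ j))) ⟩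
  0ℤ + ∑[ j < n ] (δ i j * f (Fin.suc j)) ≡⟨ +-identityˡ _ ⟩
  ∑[ j < n ] (δ i j * f (Fin.suc j)) ≡⟨ ∑-δ i (f ∘ Fin.suc) ⟩
  f (Fin.suc i) ∎
  where
  open ≡-Reasoning
  suc-≟ : ∀ j → does (Fin.suc i Fin.≟ Fin.suc j) ≡ does (i Fin.≟ j)
  suc-≟ j with i Fin.≟ j
  ... | yes _ = refl
  ... | no _  = refl

𝟏-∙ : ∀ (v : Vec n) → 𝟏 ∙ v ≡ sum v
𝟏-∙ v = sum-cong-≗ (λ i → *-identityˡ (v i))

∙-comm : ∀ (u v : Vec n) → u ∙ v ≡ v ∙ u
∙-comm u v = sum-cong-≗ (λ i → *-comm (u i) (v i))

∑-mono-≤ : ∀ {f g : Vec n} → (∀ i → f i ≤ g i) → sum f ≤ sum g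
∑-mono-≤ {zero}  f≤g = ≤-refl
∑-mono-≤ {suc n} f≤g = +-mono-≤ (f≤g Fin.zero) (∑-mono-≤ (f≤g ∘ Fin.suc))

∑-nonneg : ∀ {f : Vec n} → (∀ i → 0ℤ ≤ f i) → 0ℤ ≤ sum f
∑-nonneg {n} {f} 0≤f = subst (_≤ sum f) (∑-zero n) (∑-mono-≤ 0≤f)

abs-* : ∀ i j → abs (i * j) ≡ abs i * abs j
abs-* i j = trans (cong +_ (∣i*j∣≡∣i∣*∣j∣ i j)) (pos-* ∣ i ∣ ∣ j ∣)

abs-+ : ∀ i j → abs (i + j) ≤ abs i + abs j
abs-+ i j = +≤+ (∣i+j∣≤∣i∣+∣j∣ i j)

abs-−-− : ∀ x y z → abs (x - y - z) ≤ abs x + abs y + abs z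
abs-−-− x y z = ≤-trans (abs-+ (x - y) (- z))
  (+-mono-≤ (≤-trans (abs-+ x (- y)) (≤-reflexive (cong (λ i → abs x + + i) (∣-i∣≡∣i∣ y))))
            (≤-reflexive (cong +_ (∣-i∣≡∣i∣ z))))

abs-∑ : ∀ (f : Vec n) → abs (sum f) ≤ ∑[ i < n ] abs (f i)
abs-∑ {zero}  f = ≤-refl
abs-∑ {suc n} f = ≤-trans (+≤+ (∣i+j∣≤∣i∣+∣j∣ (f Fin.zero) _)) (+-monoʳ-≤ (abs (f Fin.zero)) (abs-∑ (f ∘ Fin.suc)))

abs-∑-≤ : ∀ {f : Vec n} {c} → (∀ i → abs (f i) ≤ c) → abs (sum f) ≤ + n * c
abs-∑-≤ {n} {f} {c} abs-f≤c = ≤-trans (abs-∑ f) (subst (sum (abs ∘ f) ≤_) (∑-const n c) (∑-mono-≤ abs-f≤c))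

i*i≡abs*abs : ∀ i → i * i ≡ abs i * abs i
i*i≡abs*abs (+ n)    = refl
i*i≡abs*abs -[1+ n ] = refl

i≤abs : ∀ i → i ≤ abs i
i≤abs (+ n)    = ≤-refl
i≤abs -[1+ n ] = -≤+

-i≤abs : ∀ i → - i ≤ abs i
-i≤abs i = subst (- i ≤_) (cong +_ (∣-i∣≡∣i∣ i)) (i≤abs (- i))

0≤i*j : ∀ {i j} → 0ℤ ≤ i → 0ℤ ≤ j → 0ℤ ≤ i * j
0≤i*j (+≤+ {n = m} _) (+≤+ {n = n} _) = subst (0ℤ ≤_) (pos-* m n) (+≤+ z≤n)

0≤i*i : ∀ i → 0ℤ ≤ i * i
0≤i*i i = subst (0ℤ ≤_) (sym (i*i≡abs*abs i)) (0≤i*j {abs i} (+≤+ z≤n) (+≤+ z≤n))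

*-monoˡ-≤-0≤ : ∀ {c i j} → 0ℤ ≤ c → i ≤ j → c * i ≤ c * j
*-monoˡ-≤-0≤ {c} 0≤c = *-monoˡ-≤-nonNeg c {{nonNegative 0≤c}}

*-monoʳ-≤-0≤ : ∀ {c i j} → 0ℤ ≤ c → i ≤ j → i * c ≤ j * c
*-monoʳ-≤-0≤ {c} 0≤c = *-monoʳ-≤-nonNeg c {{nonNegative 0≤c}}

*-mono-≤-nonNeg : ∀ {i j k l} → 0ℤ ≤ i → 0ℤ ≤ l → i ≤ j → k ≤ l → i * k ≤ j * l
*-mono-≤-nonNeg 0≤i 0≤l i≤j k≤l = ≤-trans (*-monoˡ-≤-0≤ 0≤i k≤l) (*-monoʳ-≤-0≤ 0≤l i≤j)

abs≤⇒i*i≤j*j : ∀ i {j} → abs i ≤ j → i * i ≤ j * j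
abs≤⇒i*i≤j*j i abs-i≤j = subst (_≤ _) (sym (i*i≡abs*abs i))
  (*-mono-≤-nonNeg (+≤+ z≤n) (≤-trans (+≤+ z≤n) abs-i≤j) abs-i≤j abs-i≤j)

i*i≤j*j⇒abs≤ : ∀ i j → i * i ≤ j * j → 0ℤ ≤ j → abs i ≤ j
i*i≤j*j⇒abs≤ i j i²≤j² 0≤j = subst (abs i ≤_) (0≤i⇒+∣i∣≡i 0≤j) (+≤+ (m*m≤n*n⇒m≤n (drop‿+≤+ ∣i∣²≤∣j∣²)))
  where
  ∣i∣²≤∣j∣² : + (∣ i ∣ ℕ.* ∣ i ∣) ≤ + (∣ j ∣ ℕ.* ∣ j ∣)
  ∣i∣²≤∣j∣² = subst₂ _≤_ (trans (i*i≡abs*abs i) (sym (pos-* ∣ i ∣ ∣ i ∣)))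
                         (trans (i*i≡abs*abs j) (sym (pos-* ∣ j ∣ ∣ j ∣))) i²≤j²
  m*m≤n*n⇒m≤n : ∀ {m n} → m ℕ.* m ℕ.≤ n ℕ.* n → m ℕ.≤ n
  m*m≤n*n⇒m≤n {m} {n} m²≤n² with m ℕ.≤? n
  ... | yes m≤n = m≤n
  ... | no  m≰n = ⊥-elim (ℕ.<⇒≱ (ℕ.*-mono-< (ℕ.≰⇒> m≰n) (ℕ.≰⇒> m≰n)) m²≤n²)

+-cancelˡ-≤ : ∀ {i j k} → i + j ≤ i + k → j ≤ k
+-cancelˡ-≤ {i} {j} {k} i+j≤i+k = subst₂ _≤_ (cancel i j) (cancel i k) (+-monoˡ-≤ (- i) i+j≤i+k)
  where
  cancel : ∀ i j → i + j + - i ≡ j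
  cancel = solve-∀

[x-y]²≤x²+2x∣y∣+y² : ∀ {x} y → 0ℤ ≤ x → (x - y) * (x - y) ≤ x * x + + 2 * x * abs y + abs y * abs y
[x-y]²≤x²+2x∣y∣+y² {x} y 0≤x = begin
  (x - y) * (x - y)                       ≡⟨ expand x y ⟩
  x * x + + 2 * x * (- y) + y * y
    ≤⟨ +-mono-≤ (+-monoʳ-≤ (x * x) (*-monoˡ-≤-0≤ (0≤i*j {+ 2} (+≤+ z≤n) 0≤x) (-i≤abs y)))
                (≤-reflexive (i*i≡abs*abs y)) ⟩
  x * x + + 2 * x * abs y + abs y * abs y ∎
  where
  open ≤-Reasoning
  expand : ∀ x y → (x - y) * (x - y) ≡ x * x + + 2 * x * (- y) + y * y
  expand = solve-∀

[x+y]²≤2x²+2y² : ∀ z r → (z + r) * (z + r) ≤ + 2 * (z * z) + + 2 * (r * r)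
[x+y]²≤2x²+2y² z r = subst ((z + r) * (z + r) ≤_) (expand z r)
  (i≤i+j ((z + r) * (z + r)) ((z - r) * (z - r)) {{nonNegative (0≤i*i (z - r))}})
  where
  expand : ∀ z r → (z + r) * (z + r) + (z - r) * (z - r) ≡ + 2 * (z * z) + + 2 * (r * r)
  expand = solve-∀

x²≤2[x+y]²+2y² : ∀ x y → x * x ≤ + 2 * ((x + y) * (x + y)) + + 2 * (y * y)
x²≤2[x+y]²+2y² x y = subst (x * x ≤_) (expand x y) (i≤i+j (x * x) ((x + + 2 * y) * (x + + 2 * y)) {{nonNegative (0≤i*i (x + + 2 * y))}})
  where
  expand : ∀ x y → x * x + (x + + 2 * y) * (x + + 2 * y) ≡ + 2 * ((x + y) * (x + y)) + + 2 * (y * y)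
  expand = solve-∀

-- For N > 12a the D-terms on the right are absorbed by the left-hand side.
ND≤⇒D≤ : ∀ {N a D} → 0ℤ ≤ a → 0ℤ ≤ D → + 12 * a < N →
  N * D ≤ + 6 * a * D + + 5 * (a * a) * (N * N) → D ≤ + 10 * (a * a) * N
ND≤⇒D≤ {N} {a} {D} 0≤a 0≤D 12a<N ND≤ = *-cancelˡ-≤-pos D (+ 10 * (a * a) * N) N {{positive 0<N}} (begin
  N * D                                    ≤⟨ +-cancelˡ-≤ {N * D} (begin
    N * D + N * D                            ≤⟨ +-mono-≤ ND≤ ND≤ ⟩
    X + X                                    ≡⟨ double a D (N * N) ⟩
    + 12 * a * D + + 10 * (a * a) * (N * N)  ≤⟨ +-monoˡ-≤ (+ 10 * (a * a) * (N * N)) (*-monoʳ-≤-0≤ 0≤D (<⇒≤ 12a<N)) ⟩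
    N * D + + 10 * (a * a) * (N * N)         ∎) ⟩
  + 10 * (a * a) * (N * N)                 ≡⟨ reorder a N ⟩
  N * (+ 10 * (a * a) * N)                 ∎)
  where
  open ≤-Reasoning
  double : ∀ a D M → (+ 6 * a * D + + 5 * (a * a) * M) + (+ 6 * a * D + + 5 * (a * a) * M)
                     ≡ + 12 * a * D + + 10 * (a * a) * M
  double = solve-∀
  reorder : ∀ a N → + 10 * (a * a) * (N * N) ≡ N * (+ 10 * (a * a) * N)
  reorder = solve-∀
  X : ℤ
  X = + 6 * a * D + + 5 * (a * a) * (N * N)
  0<N : 0ℤ < N
  0<N = ≤-<-trans (0≤i*j {+ 12} (+≤+ z≤n) 0≤a) 12a<N

cubic⇒linear : ∀ {N a D} → 0ℤ ≤ N → 0ℤ ≤ a → 0ℤ ≤ D → D ≤ N * N * N →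
  N * N * N * D ≤ + 6 * a * (N * N * D) + + 5 * (a * a) * (N * N * (N * N)) →
  D ≤ + 144 * (a * a) * N
cubic⇒linear {N} {a} {D} 0≤N 0≤a 0≤D D≤N³ cubic with N ≤? + 12 * a
... | yes N≤12a = begin
  D                          ≤⟨ D≤N³ ⟩
  N * N * N                  ≤⟨ *-monoʳ-≤-0≤ 0≤N (*-mono-≤-nonNeg 0≤N 0≤12a N≤12a N≤12a) ⟩
  + 12 * a * (+ 12 * a) * N  ≡⟨ square a N ⟩
  + 144 * (a * a) * N        ∎
  where
  open ≤-Reasoning
  square : ∀ a N → + 12 * a * (+ 12 * a) * N ≡ + 144 * (a * a) * N
  square = solve-∀
  0≤12a : 0ℤ ≤ + 12 * a
  0≤12a = 0≤i*j {+ 12} (+≤+ z≤n) 0≤a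
... | no  N≰12a = begin
  D                      ≤⟨ ND≤⇒D≤ 0≤a 0≤D 12a<N (cancel-N (cancel-N (subst₂ _≤_ (assoc N D) (factor N D a) cubic))) ⟩
  + 10 * (a * a) * N     ≤⟨ *-monoʳ-≤-0≤ 0≤N (*-monoʳ-≤-0≤ (0≤i*i a) (+≤+ (ℕ.m≤m+n 10 134))) ⟩
  + 144 * (a * a) * N    ∎
  where
  open ≤-Reasoning
  assoc : ∀ N D → N * N * N * D ≡ N * (N * (N * D))
  assoc = solve-∀
  factor : ∀ N D a → + 6 * a * (N * N * D) + + 5 * (a * a) * (N * N * (N * N))
                     ≡ N * (N * (+ 6 * a * D + + 5 * (a * a) * (N * N)))
  factor = solve-∀
  12a<N : + 12 * a < N
  12a<N = ≰⇒> N≰12a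
  cancel-N : ∀ {i j} → N * i ≤ N * j → i ≤ j
  cancel-N = *-cancelˡ-≤-pos _ _ N {{positive (≤-<-trans (0≤i*j {+ 12} (+≤+ z≤n) 0≤a) 12a<N)}}

-- The Cauchy–Schwarz inequality

lagrange : ∀ (u v : Vec n) →
  ∑[ i < n ] ∑[ j < n ] ((u i * v j - u j * v i) * (u i * v j - u j * v i))
    ≡ (v ∙ v) * (u ∙ u) + (u ∙ u) * (v ∙ v) + - + 2 * (u ∙ v) * (u ∙ v)
lagrange {n} u v = begin
  ∑[ i < n ] ∑[ j < n ] ((u i * v j - u j * v i) * (u i * v j - u j * v i))
    ≡⟨ sum-cong-≗ (λ i → trans (sum-cong-≗ (λ j → expand (u i) (v i) (u j) (v j)))
                                (∑-linear (u i * u i) (v i * v i) (- + 2 * u i * v i)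
                                          (λ j → v j * v j) (λ j → u j * u j) (λ j → u j * v j))) ⟩
  ∑[ i < n ] (u i * u i * (v ∙ v) + v i * v i * (u ∙ u) + - + 2 * u i * v i * (u ∙ v))
    ≡⟨ sum-cong-≗ (λ i → regroup (u i) (v i) (v ∙ v) (u ∙ u) (u ∙ v)) ⟩
  ∑[ i < n ] ((v ∙ v) * (u i * u i) + (u ∙ u) * (v i * v i) + - + 2 * (u ∙ v) * (u i * v i))
    ≡⟨ ∑-linear (v ∙ v) (u ∙ u) (- + 2 * (u ∙ v)) (λ i → u i * u i) (λ i → v i * v i) (λ i → u i * v i) ⟩
  (v ∙ v) * (u ∙ u) + (u ∙ u) * (v ∙ v) + - + 2 * (u ∙ v) * (u ∙ v) ∎
  where
  open ≡-Reasoning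
  expand : ∀ a b c d → (a * d - c * b) * (a * d - c * b) ≡ a * a * (d * d) + b * b * (c * c) + - + 2 * a * b * (c * d)
  expand = solve-∀
  regroup : ∀ a b B A S → a * a * B + b * b * A + - + 2 * a * b * S ≡ B * (a * a) + A * (b * b) + - + 2 * S * (a * b)
  regroup = solve-∀

cauchy-schwarz : ∀ (u v : Vec n) → (u ∙ v) * (u ∙ v) ≤ (u ∙ u) * (v ∙ v)
cauchy-schwarz u v = *-cancelˡ-≤-pos _ _ (+ 2) (0≤i-j⇒j≤i (subst (0ℤ ≤_) (trans (lagrange u v) (twice (u ∙ u) (v ∙ v) (u ∙ v)))
  (∑-nonneg (λ i → ∑-nonneg (λ j → 0≤i*i (u i * v j - u j * v i))))))
  where
  twice : ∀ A B S → B * A + A * B + - + 2 * S * S ≡ + 2 * (A * B) - + 2 * (S * S)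
  twice = solve-∀

abs∙abs : ∀ (v : Vec n) → (abs ∘ v) ∙ (abs ∘ v) ≡ v ∙ v
abs∙abs v = sum-cong-≗ (λ i → sym (i*i≡abs*abs (v i)))

∑abs-squared≤ : ∀ (v : Vec n) → sum (abs ∘ v) * sum (abs ∘ v) ≤ + n * (v ∙ v)
∑abs-squared≤ {n} v = begin
  sum (abs ∘ v) * sum (abs ∘ v)          ≡⟨ cong₂ _*_ (𝟏-∙ (abs ∘ v)) (𝟏-∙ (abs ∘ v)) ⟨
  𝟏 ∙ (abs ∘ v) * 𝟏 ∙ (abs ∘ v)          ≤⟨ cauchy-schwarz 𝟏 (abs ∘ v) ⟩
  𝟏 {n} ∙ 𝟏 * (abs ∘ v) ∙ (abs ∘ v)     ≡⟨ cong₂ _*_ (trans (𝟏-∙ (𝟏 {n})) (trans (∑-const n 1ℤ) (*-identityʳ (+ n))))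
                                                      (abs∙abs v) ⟩
  + n * (v ∙ v)                          ∎
  where open ≤-Reasoning

χ : (Fin n → Bool) → Vec n
χ b i = [ b i ]

χ-idem : ∀ (b : Fin n → Bool) i → χ b i * χ b i ≡ χ b i
χ-idem b i with b i
... | true  = refl
... | false = refl

0≤χ : ∀ (b : Fin n → Bool) i → 0ℤ ≤ χ b i
0≤χ b i with b i
... | true  = +≤+ z≤n
... | false = +≤+ z≤n

χ≤1 : ∀ (b : Fin n → Bool) i → χ b i ≤ 1ℤ
χ≤1 b i with b i
... | true  = ≤-refl
... | false = +≤+ z≤n

χ∙χ : ∀ (b : Fin n → Bool) → χ b ∙ χ b ≡ sum (χ b)
χ∙χ b = sum-cong-≗ (χ-idem b)

0≤∑χ : ∀ (b : Fin n → Bool) → 0ℤ ≤ sum (χ b)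
0≤∑χ b = ∑-nonneg (0≤χ b)

∑χ≤n : ∀ (b : Fin n → Bool) → sum (χ b) ≤ + n
∑χ≤n {n} b = subst (sum (χ b) ≤_) (trans (∑-const n 1ℤ) (*-identityʳ (+ n))) (∑-mono-≤ (χ≤1 b))

[∧] : ∀ x y → [ x ∧ y ] ≡ [ x ] * [ y ]
[∧] true  y = sym (*-identityˡ [ y ])
[∧] false y = refl

χ*χ≤χ : ∀ (b b′ : Fin n → Bool) i → χ b i * χ b′ i ≤ χ b i
χ*χ≤χ b b′ i with b i | b′ i
... | true  | true  = ≤-refl
... | true  | false = +≤+ z≤n
... | false | _     = ≤-refl

0≤χ*χ : ∀ (b b′ : Fin n → Bool) i → 0ℤ ≤ χ b i * χ b′ i
0≤χ*χ b b′ i = 0≤i*j (0≤χ b i) (0≤χ b′ i)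

∑χ*χ≤∑χˡ : ∀ (b b′ : Fin n → Bool) → ∑[ i < n ] (χ b i * χ b′ i) ≤ sum (χ b)
∑χ*χ≤∑χˡ b b′ = ∑-mono-≤ (χ*χ≤χ b b′)

∑χ*χ≤∑χʳ : ∀ (b b′ : Fin n → Bool) → ∑[ i < n ] (χ b i * χ b′ i) ≤ sum (χ b′)
∑χ*χ≤∑χʳ {n} b b′ = subst (_≤ sum (χ b′)) (sum-cong-≗ (λ i → *-comm (χ b′ i) (χ b i))) (∑χ*χ≤∑χˡ b′ b)

Matrix : ℕ → Set
Matrix n = Fin n → Fin n → ℤ

_·_ : Matrix n → Vec n → Vec n
_·_ {n} M v i = ∑[ j < n ] (M i j * v j)

_·ᴹ_ : Matrix n → Matrix n → Matrix n
_·ᴹ_ {n} M M′ i k = ∑[ j < n ] (M i j * M′ j k)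

infixr 9 _·_ _·ᴹ_

Symmetric : Matrix n → Set
Symmetric M = ∀ i j → M i j ≡ M j i

·-assoc : ∀ (M M′ : Matrix n) v i → (M · M′ · v) i ≡ ((M ·ᴹ M′) · v) i
·-assoc {n} M M′ v i = begin
  ∑[ j < n ] (M i j * ∑[ k < n ] (M′ j k * v k))   ≡⟨ sum-cong-≗ (λ j → *-distribˡ-sum (M i j) (λ k → M′ j k * v k)) ⟩
  ∑[ j < n ] ∑[ k < n ] (M i j * (M′ j k * v k))   ≡⟨ ∑-comm (λ j k → M i j * (M′ j k * v k)) ⟩
  ∑[ k < n ] ∑[ j < n ] (M i j * (M′ j k * v k))
    ≡⟨ sum-cong-≗ (λ k → trans (sum-cong-≗ (λ j → sym (*-assoc (M i j) (M′ j k) (v k))))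
                               (sym (*-distribʳ-sum (v k) (λ j → M i j * M′ j k)))) ⟩
  ∑[ k < n ] ((M ·ᴹ M′) i k * v k) ∎
  where open ≡-Reasoning

·-self-adjoint : ∀ {M : Matrix n} → Symmetric M → ∀ u v → (M · u) ∙ v ≡ u ∙ (M · v)
·-self-adjoint {n} {M} M-sym u v = begin
  ∑[ i < n ] (∑[ j < n ] (M i j * u j) * v i)   ≡⟨ sum-cong-≗ (λ i → *-distribʳ-sum (v i) (λ j → M i j * u j)) ⟩
  ∑[ i < n ] ∑[ j < n ] (M i j * u j * v i)     ≡⟨ ∑-comm (λ i j → M i j * u j * v i) ⟩
  ∑[ j < n ] ∑[ i < n ] (M i j * u j * v i)
    ≡⟨ sum-cong-≗ (λ j → trans (sum-cong-≗ (λ i → trans (cong (λ m → m * u j * v i) (M-sym i j)) (reorder (M j i) (u j) (v i))))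
                               (sym (*-distribˡ-sum (u j) (λ i → M j i * v i)))) ⟩
  ∑[ j < n ] (u j * ∑[ i < n ] (M j i * v i)) ∎
  where
  open ≡-Reasoning
  reorder : ∀ a x y → a * x * y ≡ x * (a * y)
  reorder = solve-∀

∙-·-double : ∀ (u : Vec n) M (v : Vec n) → u ∙ (M · v) ≡ ∑[ s < n ] ∑[ t < n ] (u s * (M s t * v t))
∙-·-double u M v = sum-cong-≗ (λ s → *-distribˡ-sum (u s) (λ t → M s t * v t))

∙-·-split : ∀ (c x y : Vec n) M →
  x ∙ (M · y) ≡ (λ s → c s * x s) ∙ (M · (λ t → c t * y t))
              + (λ s → c s * x s) ∙ (M · (λ t → (1ℤ - c t) * y t))
              + (λ s → (1ℤ - c s) * x s) ∙ (M · y)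
∙-·-split {n} c x y M = begin
  x ∙ (M · y)                                            ≡⟨ ∙-·-double x M y ⟩
  ∑[ s < n ] ∑[ t < n ] (x s * (M s t * y t))
    ≡⟨ sum-cong-≗ (λ s → trans (sum-cong-≗ (λ t → split (c s) (c t) (x s) (M s t) (y t)))
                               (∑-distrib-+₃ (λ t → cx s * (M s t * cy t)) (λ t → cx s * (M s t * c̄y t))
                                             (λ t → c̄x s * (M s t * y t)))) ⟩
  ∑[ s < n ] (∑[ t < n ] (cx s * (M s t * cy t)) + ∑[ t < n ] (cx s * (M s t * c̄y t))
             + ∑[ t < n ] (c̄x s * (M s t * y t)))
    ≡⟨ ∑-distrib-+₃ (λ s → ∑[ t < n ] (cx s * (M s t * cy t))) (λ s → ∑[ t < n ] (cx s * (M s t * c̄y t)))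
                    (λ s → ∑[ t < n ] (c̄x s * (M s t * y t))) ⟩
  ∑[ s < n ] ∑[ t < n ] (cx s * (M s t * cy t)) + ∑[ s < n ] ∑[ t < n ] (cx s * (M s t * c̄y t))
    + ∑[ s < n ] ∑[ t < n ] (c̄x s * (M s t * y t))
    ≡⟨ cong₂ _+_ (cong₂ _+_ (∙-·-double cx M cy) (∙-·-double cx M c̄y)) (∙-·-double c̄x M y) ⟨
  cx ∙ (M · cy) + cx ∙ (M · c̄y) + c̄x ∙ (M · y)          ∎
  where
  open ≡-Reasoning
  split : ∀ cs ct xs m yt → xs * (m * yt) ≡ cs * xs * (m * (ct * yt)) + cs * xs * (m * ((1ℤ - ct) * yt)) + (1ℤ - cs) * xs * (m * yt)
  split = solve-∀
  cx cy c̄x c̄y : Vec n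
  cx s = c s * x s
  cy t = c t * y t
  c̄x s = (1ℤ - c s) * x s
  c̄y t = (1ℤ - c t) * y t

abs-bilinear≤ : ∀ (M : Matrix n) → (∀ s t → abs (M s t) ≤ 1ℤ) → ∀ {x y : Vec n} →
  (∀ i → 0ℤ ≤ x i) → (∀ i → 0ℤ ≤ y i) → abs (x ∙ (M · y)) ≤ sum x * sum y
abs-bilinear≤ {n} M M-bounded {x} {y} 0≤x 0≤y = begin
  abs (x ∙ (M · y))                        ≤⟨ abs-∑ (λ s → x s * (M · y) s) ⟩
  ∑[ s < n ] abs (x s * (M · y) s)         ≡⟨ sum-cong-≗ (λ s → trans (abs-* (x s) ((M · y) s))
                                                                      (cong (_* abs ((M · y) s)) (0≤i⇒+∣i∣≡i (0≤x s)))) ⟩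
  ∑[ s < n ] (x s * abs ((M · y) s))       ≤⟨ ∑-mono-≤ (λ s → *-monoˡ-≤-0≤ (0≤x s) (abs-row s)) ⟩
  ∑[ s < n ] (x s * sum y)                 ≡⟨ *-distribʳ-sum (sum y) x ⟨
  sum x * sum y                            ∎
  where
  open ≤-Reasoning
  abs-term : ∀ s t → abs (M s t * y t) ≤ y t
  abs-term s t = begin
    abs (M s t * y t)          ≡⟨ abs-* (M s t) (y t) ⟩
    abs (M s t) * abs (y t)    ≤⟨ *-monoʳ-≤-0≤ (+≤+ z≤n) (M-bounded s t) ⟩
    1ℤ * abs (y t)             ≡⟨ trans (*-identityˡ (abs (y t))) (0≤i⇒+∣i∣≡i (0≤y t)) ⟩
    y t                        ∎
  abs-row : ∀ s → abs ((M · y) s) ≤ sum y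
  abs-row s = ≤-trans (abs-∑ (λ t → M s t * y t)) (∑-mono-≤ (abs-term s))

-- The codegree excess of a symmetric matrix

module Excess {n : ℕ} (P : Matrix n) (P-sym : Symmetric P) where

  N : ℤ
  N = + n

  r : Vec n
  r = P · 𝟏

  -- For P = J - 2A with A the adjacency matrix of a graph on n vertices,
  -- E t u = 4 A²(t,u) - n: the deviation of the codegrees from n/4.
  E : Matrix n
  E t u = (P ·ᴹ P) t u - r t - r u

  e : Vec n
  e = E · 𝟏

  σ β : ℤ
  σ = sum r
  β = sum e

  P²·-expand : ∀ v t → ((P ·ᴹ P) · v) t ≡ (E · v) t + r t * sum v + r ∙ v
  P²·-expand v t = begin
    ∑[ u < n ] ((P ·ᴹ P) t u * v u)
      ≡⟨ sum-cong-≗ (λ u → split ((P ·ᴹ P) t u) (r t) (r u) (v u)) ⟩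
    ∑[ u < n ] (1ℤ * (E t u * v u) + r t * v u + 1ℤ * (r u * v u))
      ≡⟨ ∑-linear 1ℤ (r t) 1ℤ (λ u → E t u * v u) v (λ u → r u * v u) ⟩
    1ℤ * (E · v) t + r t * sum v + 1ℤ * (r ∙ v)
      ≡⟨ cong₂ (λ x y → x + r t * sum v + y) (*-identityˡ ((E · v) t)) (*-identityˡ (r ∙ v)) ⟩
    (E · v) t + r t * sum v + r ∙ v ∎
    where
    open ≡-Reasoning
    split : ∀ g a b y → g * y ≡ 1ℤ * ((g - a - b) * y) + a * y + 1ℤ * (b * y)
    split = solve-∀

  P·v∙P·v : ∀ v → (P · v) ∙ (P · v) ≡ v ∙ (E · v) + + 2 * sum v * (r ∙ v)
  P·v∙P·v v = begin
    (P · v) ∙ (P · v)                         ≡⟨ ·-self-adjoint P-sym v (P · v) ⟩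
    v ∙ (P · P · v)                           ≡⟨ sum-cong-≗ (λ t → cong (v t *_) (trans (·-assoc P P v t) (P²·-expand v t))) ⟩
    ∑[ t < n ] (v t * ((E · v) t + r t * sum v + r ∙ v))
      ≡⟨ sum-cong-≗ (λ t → spread (v t) ((E · v) t) (r t) (sum v) (r ∙ v)) ⟩
    ∑[ t < n ] (1ℤ * (v t * (E · v) t) + sum v * (r t * v t) + r ∙ v * v t)
      ≡⟨ ∑-linear 1ℤ (sum v) (r ∙ v) (λ t → v t * (E · v) t) (λ t → r t * v t) v ⟩
    1ℤ * (v ∙ (E · v)) + sum v * (r ∙ v) + r ∙ v * sum v ≡⟨ collect (v ∙ (E · v)) (sum v) (r ∙ v) ⟩
    v ∙ (E · v) + + 2 * sum v * (r ∙ v) ∎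
    where
    open ≡-Reasoning
    spread : ∀ x a b s c → x * (a + b * s + c) ≡ 1ℤ * (x * a) + s * (b * x) + c * x
    spread = solve-∀
    collect : ∀ q s c → 1ℤ * q + s * c + c * s ≡ q + + 2 * s * c
    collect = solve-∀

  P·r≡Nr+e+σ : ∀ u → (P · r) u ≡ N * r u + e u + σ
  P·r≡Nr+e+σ u = begin
    (P · P · 𝟏) u                              ≡⟨ ·-assoc P P 𝟏 u ⟩
    ((P ·ᴹ P) · 𝟏) u                           ≡⟨ P²·-expand 𝟏 u ⟩
    e u + r u * sum (𝟏 {n}) + r ∙ 𝟏
      ≡⟨ cong₂ (λ x y → e u + r u * x + y) (∑-const n 1ℤ) (trans (∙-comm r 𝟏) (𝟏-∙ r)) ⟩
    e u + r u * (N * 1ℤ) + σ                   ≡⟨ cong (λ x → x + σ) (reorder (e u) (r u) N) ⟩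
    N * r u + e u + σ ∎
    where
    open ≡-Reasoning
    reorder : ∀ x y m → x + y * (m * 1ℤ) ≡ m * y + x
    reorder = solve-∀

  ∑P·r≡r∙r : sum (P · r) ≡ r ∙ r
  ∑P·r≡r∙r = begin
    sum (P · r)        ≡⟨ 𝟏-∙ (P · r) ⟨
    𝟏 ∙ (P · r)        ≡⟨ ·-self-adjoint P-sym 𝟏 r ⟨
    r ∙ r              ∎
    where open ≡-Reasoning

  w : Vec n
  w u = N * r u + e u

  r∙r≡∑w+Nσ : r ∙ r ≡ sum w + N * σ
  r∙r≡∑w+Nσ = trans (sym ∑P·r≡r∙r) (trans (sum-cong-≗ P·r≡Nr+e+σ) (∑-+-const w σ))

  ∑w≡Nσ+β : sum w ≡ N * σ + β
  ∑w≡Nσ+β = trans (∑-distrib-+ (λ u → N * r u) e) (cong (_+ β) (sym (*-distribˡ-sum N r)))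

  w∙w≡r∙E·r+Nσ² : w ∙ w ≡ r ∙ (E · r) + N * σ * σ
  w∙w≡r∙E·r+Nσ² = begin
    w ∙ w                                                      ≡⟨ solve₁ (w ∙ w) σ (sum w) N ⟩
    (w ∙ w + + 2 * σ * sum w + N * (σ * σ)) - + 2 * σ * (sum w + N * σ) + N * σ * σ
      ≡⟨ cong₂ (λ x y → x - + 2 * σ * y + N * σ * σ) (sym (∑-+-const-sq w σ)) (sym r∙r≡∑w+Nσ) ⟩
    ∑[ u < n ] ((w u + σ) * (w u + σ)) - + 2 * σ * (r ∙ r) + N * σ * σ
      ≡⟨ cong (λ x → x - + 2 * σ * (r ∙ r) + N * σ * σ)
              (trans (sum-cong-≗ (λ u → sym (cong₂ _*_ (P·r≡Nr+e+σ u) (P·r≡Nr+e+σ u)))) (P·v∙P·v r)) ⟩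
    r ∙ (E · r) + + 2 * σ * (r ∙ r) - + 2 * σ * (r ∙ r) + N * σ * σ ≡⟨ solve₂ (r ∙ (E · r)) σ (r ∙ r) N ⟩
    r ∙ (E · r) + N * σ * σ ∎
    where
    open ≡-Reasoning
    solve₁ : ∀ x s t m → x ≡ (x + + 2 * s * t + m * (s * s)) - + 2 * s * (t + m * s) + m * s * s
    solve₁ = solve-∀
    solve₂ : ∀ q s d m → q + + 2 * s * d - + 2 * s * d + m * s * s ≡ q + m * s * s
    solve₂ = solve-∀

  energy-identity : + 4 * N * (w ∙ w) ≡ + 4 * N * (r ∙ (E · r)) + (r ∙ r - β) * (r ∙ r - β)
  energy-identity = begin
    + 4 * N * (w ∙ w)                         ≡⟨ cong (+ 4 * N *_) w∙w≡r∙E·r+Nσ² ⟩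
    + 4 * N * (r ∙ (E · r) + N * σ * σ)       ≡⟨ solve₁ N (r ∙ (E · r)) σ ⟩
    + 4 * N * (r ∙ (E · r)) + (+ 2 * N * σ) * (+ 2 * N * σ)  ≡⟨ cong (λ x → + 4 * N * (r ∙ (E · r)) + x * x) 2Nσ ⟨
    + 4 * N * (r ∙ (E · r)) + (r ∙ r - β) * (r ∙ r - β) ∎
    where
    open ≡-Reasoning
    solve₁ : ∀ m q s → + 4 * m * (q + m * s * s) ≡ + 4 * m * q + (+ 2 * m * s) * (+ 2 * m * s)
    solve₁ = solve-∀
    solve₂ : ∀ m s b → m * s + b + m * s - b ≡ + 2 * m * s
    solve₂ = solve-∀
    2Nσ : r ∙ r - β ≡ + 2 * N * σ
    2Nσ = trans (cong (λ x → x - β) (trans r∙r≡∑w+Nσ (cong (_+ N * σ) ∑w≡Nσ+β))) (solve₂ N σ β)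

  module Bounded (P-bounded : ∀ s t → abs (P s t) ≤ 1ℤ) (C : ℕ)
                 (E-offdiagonal : ∀ t u → t ≢ u → abs (E t u) ≤ + C) where

    a : ℤ
    a = + C + + 3

    0≤N : 0ℤ ≤ N
    0≤N = +≤+ z≤n

    0≤a : 0ℤ ≤ a
    0≤a = +≤+ z≤n

    abs-r : ∀ t → abs (r t) ≤ N
    abs-r t = subst (abs (r t) ≤_) (*-identityʳ N)
      (abs-∑-≤ (λ s → subst (λ x → abs x ≤ 1ℤ) (sym (*-identityʳ (P t s))) (P-bounded t s)))

    abs-P² : ∀ t u → abs ((P ·ᴹ P) t u) ≤ N
    abs-P² t u = subst (abs ((P ·ᴹ P) t u) ≤_) (*-identityʳ N) (abs-∑-≤ (λ s → begin
      abs (P t s * P s u)      ≡⟨ abs-* (P t s) (P s u) ⟩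
      abs (P t s) * abs (P s u) ≤⟨ *-mono-≤-nonNeg (+≤+ z≤n) (+≤+ z≤n) (P-bounded t s) (P-bounded s u) ⟩
      1ℤ                       ∎))
      where open ≤-Reasoning

    abs-E : ∀ t u → abs (E t u) ≤ + C + + 3 * N * δ t u
    abs-E t u with t Fin.≟ u
    ... | yes refl = begin
      abs ((P ·ᴹ P) t t - r t - r t)                 ≤⟨ abs-−-− ((P ·ᴹ P) t t) (r t) (r t) ⟩
      abs ((P ·ᴹ P) t t) + abs (r t) + abs (r t)     ≤⟨ +-mono-≤ (+-mono-≤ (abs-P² t t) (abs-r t)) (abs-r t) ⟩
      N + N + N                                      ≡⟨ thrice N ⟩
      + 3 * N * 1ℤ                                   ≤⟨ i≤j+i (+ 3 * N * 1ℤ) (+ C) ⟩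
      + C + + 3 * N * 1ℤ                             ∎
      where
      open ≤-Reasoning
      thrice : ∀ N → N + N + N ≡ + 3 * N * 1ℤ
      thrice = solve-∀
    ... | no t≢u = subst (abs (E t u) ≤_) (solve₁ (+ C) N) (E-offdiagonal t u t≢u)
      where
      solve₁ : ∀ c N → c ≡ c + + 3 * N * 0ℤ
      solve₁ = solve-∀

    abs-E· : ∀ v t → abs ((E · v) t) ≤ + C * sum (abs ∘ v) + + 3 * N * abs (v t)
    abs-E· v t = begin
      abs ((E · v) t)                                          ≤⟨ abs-∑ (λ u → E t u * v u) ⟩
      ∑[ u < n ] abs (E t u * v u)                             ≡⟨ sum-cong-≗ (λ u → abs-* (E t u) (v u)) ⟩
      ∑[ u < n ] (abs (E t u) * abs (v u))                     ≤⟨ ∑-mono-≤ (λ u → *-monoʳ-≤-nonNeg (abs (v u)) (abs-E t u)) ⟩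
      ∑[ u < n ] ((+ C + + 3 * N * δ t u) * abs (v u))
        ≡⟨ sum-cong-≗ (λ u → spread (+ C) (+ 3 * N) (δ t u) (abs (v u))) ⟩
      ∑[ u < n ] (+ C * abs (v u) + + 3 * N * (δ t u * abs (v u)))
        ≡⟨ ∑-distrib-+ (λ u → + C * abs (v u)) (λ u → + 3 * N * (δ t u * abs (v u))) ⟩
      ∑[ u < n ] (+ C * abs (v u)) + ∑[ u < n ] (+ 3 * N * (δ t u * abs (v u)))
        ≡⟨ cong₂ _+_ (*-distribˡ-sum (+ C) (abs ∘ v)) (*-distribˡ-sum (+ 3 * N) (λ u → δ t u * abs (v u))) ⟨
      + C * sum (abs ∘ v) + + 3 * N * ∑[ u < n ] (δ t u * abs (v u))
        ≡⟨ cong (λ x → + C * sum (abs ∘ v) + + 3 * N * x) (∑-δ t (abs ∘ v)) ⟩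
      + C * sum (abs ∘ v) + + 3 * N * abs (v t)                ∎
      where
      open ≤-Reasoning
      spread : ∀ c m d x → (c + m * d) * x ≡ c * x + m * (d * x)
      spread = solve-∀

    abs-e : ∀ u → abs (e u) ≤ a * N
    abs-e u = ≤-trans (abs-E· 𝟏 u)
      (≤-reflexive (trans (cong (λ x → + C * x + + 3 * N * 1ℤ) (∑-const n 1ℤ)) (collect (+ C) N)))
      where
      collect : ∀ c N → c * (N * 1ℤ) + + 3 * N * 1ℤ ≡ (c + + 3) * N
      collect = solve-∀

    abs-v∙E·v : ∀ v → abs (v ∙ (E · v)) ≤ a * N * (v ∙ v)
    abs-v∙E·v v = begin
      abs (v ∙ (E · v))                                  ≤⟨ abs-∑ (λ t → v t * (E · v) t) ⟩
      ∑[ t < n ] abs (v t * (E · v) t)                   ≡⟨ sum-cong-≗ (λ t → abs-* (v t) ((E · v) t)) ⟩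
      ∑[ t < n ] (abs (v t) * abs ((E · v) t))
        ≤⟨ ∑-mono-≤ (λ t → *-monoˡ-≤-nonNeg (abs (v t)) (abs-E· v t)) ⟩
      ∑[ t < n ] (abs (v t) * (+ C * S + + 3 * N * abs (v t)))
        ≡⟨ sum-cong-≗ (λ t → spread (abs (v t)) (+ C * S) (+ 3 * N)) ⟩
      ∑[ t < n ] (+ C * S * abs (v t) + + 3 * N * (abs (v t) * abs (v t)))
        ≡⟨ ∑-distrib-+ (λ t → + C * S * abs (v t)) (λ t → + 3 * N * (abs (v t) * abs (v t))) ⟩
      ∑[ t < n ] (+ C * S * abs (v t)) + ∑[ t < n ] (+ 3 * N * (abs (v t) * abs (v t)))
        ≡⟨ cong₂ _+_ (*-distribˡ-sum (+ C * S) (abs ∘ v)) (*-distribˡ-sum (+ 3 * N) (λ t → abs (v t) * abs (v t))) ⟨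
      + C * S * S + + 3 * N * ((abs ∘ v) ∙ (abs ∘ v))
        ≤⟨ +-mono-≤ (≤-trans (≤-reflexive (*-assoc (+ C) S S)) (*-monoˡ-≤-nonNeg (+ C) (∑abs-squared≤ v)))
                    (≤-reflexive (cong (+ 3 * N *_) (abs∙abs v))) ⟩
      + C * (N * (v ∙ v)) + + 3 * N * (v ∙ v)           ≡⟨ collect (+ C) N (v ∙ v) ⟩
      a * N * (v ∙ v)                                    ∎
      where
      open ≤-Reasoning
      S : ℤ
      S = sum (abs ∘ v)
      spread : ∀ x s m → x * (s + m * x) ≡ s * x + m * (x * x)
      spread = solve-∀
      collect : ∀ c N q → c * (N * q) + + 3 * N * q ≡ (c + + 3) * N * q
      collect = solve-∀

    0≤r∙r : 0ℤ ≤ r ∙ r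
    0≤r∙r = ∑-nonneg (λ t → 0≤i*i (r t))

    r∙r≤N³ : r ∙ r ≤ N * N * N
    r∙r≤N³ = ≤-trans (∑-mono-≤ (λ t → abs≤⇒i*i≤j*j (r t) (abs-r t)))
                     (≤-reflexive (trans (∑-const n (N * N)) (sym (*-assoc N N N))))

    abs-β : abs β ≤ a * N * N
    abs-β = subst (abs β ≤_) (*-comm N (a * N)) (abs-∑-≤ abs-e)

    e∙e≤ : e ∙ e ≤ N * (a * N * (a * N))
    e∙e≤ = ≤-trans (∑-mono-≤ (λ u → abs≤⇒i*i≤j*j (e u) (abs-e u))) (≤-reflexive (∑-const n (a * N * (a * N))))

    N²r∙r≤ : N * N * (r ∙ r) ≤ + 2 * (w ∙ w) + + 2 * (e ∙ e)
    N²r∙r≤ = begin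
      N * N * (r ∙ r)                                      ≡⟨ *-distribˡ-sum (N * N) (λ t → r t * r t) ⟩
      ∑[ t < n ] (N * N * (r t * r t))                     ≡⟨ sum-cong-≗ (λ t → regroup N (r t)) ⟩
      ∑[ t < n ] ((N * r t) * (N * r t))                   ≤⟨ ∑-mono-≤ (λ t → x²≤2[x+y]²+2y² (N * r t) (e t)) ⟩
      ∑[ t < n ] (+ 2 * (w t * w t) + + 2 * (e t * e t))
        ≡⟨ ∑-distrib-+ (λ t → + 2 * (w t * w t)) (λ t → + 2 * (e t * e t)) ⟩
      ∑[ t < n ] (+ 2 * (w t * w t)) + ∑[ t < n ] (+ 2 * (e t * e t))
        ≡⟨ cong₂ _+_ (*-distribˡ-sum (+ 2) (λ t → w t * w t)) (*-distribˡ-sum (+ 2) (λ t → e t * e t)) ⟨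
      + 2 * (w ∙ w) + + 2 * (e ∙ e)                        ∎
      where
      open ≤-Reasoning
      regroup : ∀ N x → N * N * (x * x) ≡ (N * x) * (N * x)
      regroup = solve-∀

    -- The energy identity together with 2 (w ∙ w) ≥ N² D - 2 (e ∙ e); every term
    -- other than N³ D is O(N² D + N⁴).
    cubic-inequality : N * N * N * (r ∙ r) ≤ + 6 * a * (N * N * (r ∙ r)) + + 5 * (a * a) * (N * N * (N * N))
    cubic-inequality = +-cancelˡ-≤ {N * N * N * D} (begin
      N * N * N * D + N * N * N * D                      ≡⟨ solve₁ N D ⟩
      + 2 * N * (N * N * D)                              ≤⟨ *-monoˡ-≤-0≤ 0≤2N N²r∙r≤ ⟩
      + 2 * N * (+ 2 * (w ∙ w) + + 2 * (e ∙ e))          ≡⟨ solve₂ N (w ∙ w) (e ∙ e) ⟩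
      + 4 * N * (w ∙ w) + + 4 * N * (e ∙ e)              ≡⟨ cong (λ x → x + + 4 * N * (e ∙ e)) energy-identity ⟩
      + 4 * N * Q + (D - β) * (D - β) + + 4 * N * (e ∙ e)
        ≤⟨ +-mono-≤ (+-mono-≤ (*-monoˡ-≤-0≤ 0≤4N (≤-trans (i≤abs Q) (abs-v∙E·v r))) ([x-y]²≤x²+2x∣y∣+y² β 0≤r∙r))
                    (*-monoˡ-≤-0≤ 0≤4N e∙e≤) ⟩
      + 4 * N * (a * N * D) + (D * D + + 2 * D * abs β + abs β * abs β) + + 4 * N * (N * (a * N * (a * N)))
        ≤⟨ +-monoˡ-≤ (+ 4 * N * (N * (a * N * (a * N)))) (+-monoʳ-≤ (+ 4 * N * (a * N * D))
             (+-mono-≤ (+-mono-≤ (*-monoʳ-≤-0≤ 0≤r∙r r∙r≤N³) (*-monoˡ-≤-0≤ 0≤2D abs-β))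
                       (*-mono-≤-nonNeg (+≤+ z≤n) 0≤aNN abs-β abs-β))) ⟩
      + 4 * N * (a * N * D) + (N * N * N * D + + 2 * D * (a * N * N) + a * N * N * (a * N * N))
        + + 4 * N * (N * (a * N * (a * N)))             ≡⟨ solve₃ N D a ⟩
      N * N * N * D + (+ 6 * a * (N * N * D) + + 5 * (a * a) * (N * N * (N * N))) ∎)
      where
      open ≤-Reasoning
      D Q : ℤ
      D = r ∙ r
      Q = r ∙ (E · r)
      0≤2N : 0ℤ ≤ + 2 * N
      0≤2N = 0≤i*j {+ 2} (+≤+ z≤n) 0≤N
      0≤4N : 0ℤ ≤ + 4 * N
      0≤4N = 0≤i*j {+ 4} (+≤+ z≤n) 0≤N
      0≤2D : 0ℤ ≤ + 2 * D
      0≤2D = 0≤i*j {+ 2} (+≤+ z≤n) 0≤r∙r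
      0≤aNN : 0ℤ ≤ a * N * N
      0≤aNN = 0≤i*j (0≤i*j 0≤a 0≤N) 0≤N
      solve₁ : ∀ N D → N * N * N * D + N * N * N * D ≡ + 2 * N * (N * N * D)
      solve₁ = solve-∀
      solve₂ : ∀ N w e → + 2 * N * (+ 2 * w + + 2 * e) ≡ + 4 * N * w + + 4 * N * e
      solve₂ = solve-∀
      solve₃ : ∀ N D a → + 4 * N * (a * N * D) + (N * N * N * D + + 2 * D * (a * N * N) + a * N * N * (a * N * N))
                           + + 4 * N * (N * (a * N * (a * N)))
                         ≡ N * N * N * D + (+ 6 * a * (N * N * D) + + 5 * (a * a) * (N * N * (N * N)))
      solve₃ = solve-∀

    r∙r≤linear : r ∙ r ≤ + 144 * (a * a) * N
    r∙r≤linear = cubic⇒linear 0≤N 0≤a 0≤r∙r r∙r≤N³ cubic-inequality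

    χ∙χ≤N : ∀ (y : Fin n → Bool) → χ y ∙ χ y ≤ N
    χ∙χ≤N y = subst (_≤ N) (sym (χ∙χ y)) (∑χ≤n y)

    abs-r∙χ : ∀ y → abs (r ∙ χ y) ≤ + 12 * a * N
    abs-r∙χ y = i*i≤j*j⇒abs≤ (r ∙ χ y) (+ 12 * a * N) (begin
      r ∙ χ y * r ∙ χ y                    ≤⟨ cauchy-schwarz r (χ y) ⟩
      r ∙ r * χ y ∙ χ y                    ≤⟨ *-mono-≤-nonNeg 0≤r∙r 0≤N r∙r≤linear (χ∙χ≤N y) ⟩
      + 144 * (a * a) * N * N              ≡⟨ square a N ⟩
      + 12 * a * N * (+ 12 * a * N)        ∎) (0≤i*j (0≤i*j {+ 12} (+≤+ z≤n) 0≤a) 0≤N)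
      where
      open ≤-Reasoning
      square : ∀ a N → + 144 * (a * a) * N * N ≡ + 12 * a * N * (+ 12 * a * N)
      square = solve-∀

    P·χ∙P·χ≤ : ∀ y → (P · χ y) ∙ (P · χ y) ≤ + 25 * a * N * sum (χ y)
    P·χ∙P·χ≤ y = begin
      (P · χ y) ∙ (P · χ y)                               ≡⟨ P·v∙P·v (χ y) ⟩
      χ y ∙ (E · χ y) + + 2 * sum (χ y) * (r ∙ χ y)
        ≤⟨ +-mono-≤ (≤-trans (i≤abs (χ y ∙ (E · χ y))) (abs-v∙E·v (χ y)))
                    (*-monoˡ-≤-0≤ (0≤i*j {+ 2} (+≤+ z≤n) (0≤∑χ y)) (≤-trans (i≤abs (r ∙ χ y)) (abs-r∙χ y))) ⟩
      a * N * (χ y ∙ χ y) + + 2 * sum (χ y) * (+ 12 * a * N)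
        ≡⟨ cong (λ x → a * N * x + + 2 * sum (χ y) * (+ 12 * a * N)) (χ∙χ y) ⟩
      a * N * sum (χ y) + + 2 * sum (χ y) * (+ 12 * a * N)  ≡⟨ collect a N (sum (χ y)) ⟩
      + 25 * a * N * sum (χ y)                            ∎
      where
      open ≤-Reasoning
      collect : ∀ a N s → a * N * s + + 2 * s * (+ 12 * a * N) ≡ + 25 * a * N * s
      collect = solve-∀

    χ∙P·χ≤ : ∀ x y → (χ x ∙ (P · χ y)) * (χ x ∙ (P · χ y)) ≤ + 25 * a * N * (sum (χ x) * sum (χ y))
    χ∙P·χ≤ x y = begin
      (χ x ∙ (P · χ y)) * (χ x ∙ (P · χ y))              ≤⟨ cauchy-schwarz (χ x) (P · χ y) ⟩
      χ x ∙ χ x * (P · χ y) ∙ (P · χ y)                  ≤⟨ *-mono-≤-nonNeg 0≤χ∙χ (0≤i*j (0≤i*j 0≤25a 0≤N) (0≤∑χ y))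
                                                              (≤-reflexive (χ∙χ x)) (P·χ∙P·χ≤ y) ⟩
      sum (χ x) * (+ 25 * a * N * sum (χ y))             ≡⟨ reorder (sum (χ x)) (+ 25 * a * N) (sum (χ y)) ⟩
      + 25 * a * N * (sum (χ x) * sum (χ y))             ∎
      where
      open ≤-Reasoning
      0≤χ∙χ : 0ℤ ≤ χ x ∙ χ x
      0≤χ∙χ = subst (0ℤ ≤_) (sym (χ∙χ x)) (0≤∑χ x)
      0≤25a : 0ℤ ≤ + 25 * a
      0≤25a = 0≤i*j {+ 25} (+≤+ z≤n) 0≤a
      reorder : ∀ s k t → s * (k * t) ≡ k * (s * t)
      reorder = solve-∀

members : (p : Subset n) → Fin ∣ p ∣ˢ → Fin n
members (true  ∷ p) Fin.zero    = Fin.zero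
members (true  ∷ p) (Fin.suc k) = Fin.suc (members p k)
members (false ∷ p) k           = Fin.suc (members p k)

members-∈ : ∀ (p : Subset n) k → members p k ∈ p
members-∈ (true  ∷ p) Fin.zero    = here
members-∈ (true  ∷ p) (Fin.suc k) = there (members-∈ p k)
members-∈ (false ∷ p) k           = there (members-∈ p k)

members-injective : ∀ (p : Subset n) {k l} → members p k ≡ members p l → k ≡ l
members-injective (true  ∷ p) {Fin.zero}  {Fin.zero}  _  = refl
members-injective (true  ∷ p) {Fin.suc k} {Fin.suc l} eq = cong Fin.suc (members-injective p (suc-injective eq))
members-injective (false ∷ p)                         eq = members-injective p (suc-injective eq)

∑-members : ∀ (p : Subset n) (f : Vec n) → sum (f ∘ members p) ≡ ∑[ i < n ] (χ (lookup p) i * f i)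
∑-members []          f = refl
∑-members (true  ∷ p) f = cong₂ _+_ (sym (*-identityˡ (f Fin.zero))) (∑-members p (f ∘ Fin.suc))
∑-members {suc n} (false ∷ p) f = begin
  sum (f ∘ Fin.suc ∘ members p)                               ≡⟨ ∑-members p (f ∘ Fin.suc) ⟩
  ∑[ i < n ] (χ (lookup p) i * f (Fin.suc i))                 ≡⟨ +-identityˡ _ ⟨
  0ℤ + ∑[ i < n ] (χ (lookup p) i * f (Fin.suc i))
    ≡⟨ cong (_+ ∑[ i < n ] (χ (lookup p) i * f (Fin.suc i))) (*-zeroˡ (f Fin.zero)) ⟨
  0ℤ * f Fin.zero + ∑[ i < n ] (χ (lookup p) i * f (Fin.suc i)) ∎
  where open ≡-Reasoning

∑χ≡∣∣ : ∀ (p : Subset n) → sum (χ (lookup p)) ≡ + ∣ p ∣ˢ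
∑χ≡∣∣ {n} p = begin
  sum (χ (lookup p))                        ≡⟨ sum-cong-≗ (λ i → *-identityʳ (χ (lookup p) i)) ⟨
  ∑[ i < n ] (χ (lookup p) i * 1ℤ)          ≡⟨ ∑-members p 𝟏 ⟨
  sum (𝟏 {∣ p ∣ˢ})                          ≡⟨ ∑-const ∣ p ∣ˢ 1ℤ ⟩
  + ∣ p ∣ˢ * 1ℤ                              ≡⟨ *-identityʳ (+ ∣ p ∣ˢ) ⟩
  + ∣ p ∣ˢ                                   ∎
  where open ≡-Reasoning

χ-∁ : ∀ (p : Subset n) i → χ (lookup (∁ p)) i ≡ 1ℤ - χ (lookup p) i
χ-∁ p i with lookup (∁ p) i | lookup-map i not p
... | _ | refl with lookup p i
...   | true  = refl
...   | false = refl

1-χ∁ : ∀ (p : Subset n) i → 1ℤ - χ (lookup (∁ p)) i ≡ χ (lookup p) i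
1-χ∁ p i = trans (cong (λ x → 1ℤ - x) (χ-∁ p i)) (cancel (χ (lookup p) i))
  where
  cancel : ∀ x → 1ℤ - (1ℤ - x) ≡ x
  cancel = solve-∀

∑χ∁ : ∀ (p : Subset n) → + ∣ ∁ p ∣ˢ ≡ + n - + ∣ p ∣ˢ
∑χ∁ {n} p = begin
  + ∣ ∁ p ∣ˢ                          ≡⟨ ∑χ≡∣∣ (∁ p) ⟨
  sum (χ (lookup (∁ p)))              ≡⟨ sum-cong-≗ (χ-∁ p) ⟩
  ∑[ i < n ] (1ℤ - χ (lookup p) i)    ≡⟨ ∑-distrib-- 𝟏 (χ (lookup p)) ⟩
  sum (𝟏 {n}) - sum (χ (lookup p))    ≡⟨ cong₂ _-_ (trans (∑-const n 1ℤ) (*-identityʳ (+ n))) (∑χ≡∣∣ p) ⟩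
  + n - + ∣ p ∣ˢ                       ∎
  where open ≡-Reasoning

restrict : (p : Subset n) → Matrix n → Matrix ∣ p ∣ˢ
restrict p M k l = M (members p k) (members p l)

∙-·-restrict : ∀ (p : Subset n) (x y : Vec n) M →
  (λ s → χ (lookup p) s * x s) ∙ (M · (λ t → χ (lookup p) t * y t))
    ≡ (x ∘ members p) ∙ (restrict p M · (y ∘ members p))
∙-·-restrict {n} p x y M = begin
  ∑[ s < n ] (c s * x s * (M · cy) s)                  ≡⟨ sum-cong-≗ (λ s → *-assoc (c s) (x s) ((M · cy) s)) ⟩
  ∑[ s < n ] (c s * (x s * (M · cy) s))                ≡⟨ ∑-members p (λ s → x s * (M · cy) s) ⟨
  ∑[ k < ∣ p ∣ˢ ] (x (ι k) * (M · cy) (ι k))                ≡⟨ sum-cong-≗ (λ k → cong (x (ι k) *_) (restrict-row (ι k))) ⟩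
  (x ∘ ι) ∙ (restrict p M · (y ∘ ι))                   ∎
  where
  open ≡-Reasoning
  ι : Fin ∣ p ∣ˢ → Fin n
  ι = members p
  c cy : Vec n
  c = χ (lookup p)
  cy t = c t * y t
  restrict-row : ∀ s → (M · cy) s ≡ ∑[ l < ∣ p ∣ˢ ] (M s (ι l) * y (ι l))
  restrict-row s = begin
    ∑[ t < n ] (M s t * (c t * y t))    ≡⟨ sum-cong-≗ (λ t → reorder (M s t) (c t) (y t)) ⟩
    ∑[ t < n ] (c t * (M s t * y t))    ≡⟨ ∑-members p (λ t → M s t * y t) ⟨
    ∑[ l < ∣ p ∣ˢ ] (M s (ι l) * y (ι l))    ∎
    where
    reorder : ∀ a b y → a * (b * y) ≡ b * (a * y)
    reorder = solve-∀

-- Signed adjacency matrices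

module Signed {n : ℕ} (A : Fin n → Fin n → Bool) (A-sym : ∀ s t → A s t ≡ A t s) where

  P : Matrix n
  P s t = 1ℤ - + 2 * [ A s t ]

  P-sym : Symmetric P
  P-sym s t = cong (λ b → 1ℤ - + 2 * [ b ]) (A-sym s t)

  P-bounded : ∀ s t → abs (P s t) ≤ 1ℤ
  P-bounded s t with A s t
  ... | true  = ≤-refl
  ... | false = ≤-refl

  open Excess P P-sym using (E)

  codegree : Fin n → Fin n → ℤ
  codegree t u = ∑[ s < n ] ([ A t s ] * [ A s u ])

  E≡4codegree-n : ∀ t u → E t u ≡ + 4 * codegree t u - + n
  E≡4codegree-n t u = begin
    ∑[ s < n ] (P t s * P s u) - ∑[ s < n ] (P t s * 1ℤ) - ∑[ s < n ] (P u s * 1ℤ)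
      ≡⟨ cong (λ x → ∑[ s < n ] (P t s * P s u) - ∑[ s < n ] (P t s * 1ℤ) - x)
              (sum-cong-≗ (λ s → cong (_* 1ℤ) (P-sym u s))) ⟩
    ∑[ s < n ] (P t s * P s u) - ∑[ s < n ] (P t s * 1ℤ) - ∑[ s < n ] (P s u * 1ℤ)
      ≡⟨ trans (∑-distrib-- (λ s → P t s * P s u - P t s * 1ℤ) (λ s → P s u * 1ℤ))
               (cong (_- ∑[ s < n ] (P s u * 1ℤ)) (∑-distrib-- (λ s → P t s * P s u) (λ s → P t s * 1ℤ))) ⟨
    ∑[ s < n ] (P t s * P s u - P t s * 1ℤ - P s u * 1ℤ)
      ≡⟨ sum-cong-≗ (λ s → signed-codegree [ A t s ] [ A s u ]) ⟩
    ∑[ s < n ] (+ 4 * ([ A t s ] * [ A s u ]) - 1ℤ)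
      ≡⟨ ∑-distrib-- (λ s → + 4 * ([ A t s ] * [ A s u ])) 𝟏 ⟩
    ∑[ s < n ] (+ 4 * ([ A t s ] * [ A s u ])) - sum (𝟏 {n})
      ≡⟨ cong₂ _-_ (*-distribˡ-sum (+ 4) (λ s → [ A t s ] * [ A s u ])) (sym (trans (∑-const n 1ℤ) (*-identityʳ (+ n)))) ⟨
    + 4 * codegree t u - + n ∎
    where
    open ≡-Reasoning
    signed-codegree : ∀ a b → (1ℤ - + 2 * a) * (1ℤ - + 2 * b) - (1ℤ - + 2 * a) * 1ℤ - (1ℤ - + 2 * b) * 1ℤ
                              ≡ + 4 * (a * b) - 1ℤ
    signed-codegree = solve-∀

  χ∙P·χ≡ : ∀ (x y : Fin n → Bool) →
    χ x ∙ (P · χ y) ≡ sum (χ x) * sum (χ y) - + 2 * ∑[ s < n ] ∑[ t < n ] (χ x s * (χ y t * [ A s t ]))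
  χ∙P·χ≡ x y = begin
    χ x ∙ (P · χ y)                                          ≡⟨ ∙-·-double (χ x) P (χ y) ⟩
    ∑[ s < n ] ∑[ t < n ] (χ x s * (P s t * χ y t))
      ≡⟨ sum-cong-≗ (λ s → trans (sum-cong-≗ (λ t → expand (χ x s) (χ y t) [ A s t ]))
                                 (∑-sub-scaled (+ 2) (λ t → χ x s * χ y t) (λ t → χ x s * (χ y t * [ A s t ])))) ⟩
    ∑[ s < n ] (∑[ t < n ] (χ x s * χ y t) - + 2 * ∑[ t < n ] (χ x s * (χ y t * [ A s t ])))
      ≡⟨ ∑-sub-scaled (+ 2) (λ s → ∑[ t < n ] (χ x s * χ y t)) (λ s → ∑[ t < n ] (χ x s * (χ y t * [ A s t ]))) ⟩
    ∑[ s < n ] ∑[ t < n ] (χ x s * χ y t) - + 2 * ∑[ s < n ] ∑[ t < n ] (χ x s * (χ y t * [ A s t ]))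
      ≡⟨ cong (_- + 2 * ∑[ s < n ] ∑[ t < n ] (χ x s * (χ y t * [ A s t ]))) (∑-*-∑ (χ x) (χ y)) ⟨
    sum (χ x) * sum (χ y) - + 2 * ∑[ s < n ] ∑[ t < n ] (χ x s * (χ y t * [ A s t ])) ∎
    where
    open ≡-Reasoning
    expand : ∀ x y a → x * ((1ℤ - + 2 * a) * y) ≡ x * y - + 2 * (x * (y * a))
    expand = solve-∀

-- Removing a bounded exceptional set

excess-bound discrepancy-constant : ℕ → ℕ → ℕ
excess-bound         K C = 4 ℕ.* C ℕ.+ 5 ℕ.* K
discrepancy-constant K C = 50 ℕ.* (excess-bound K C ℕ.+ 3) ℕ.+ 8 ℕ.* K

module Discrepancy {q : ℕ} (adj : Fin q → Fin q → Bool) (adj-sym : ∀ s t → adj s t ≡ adj t s)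
  (B : Subset q) (K C : ℕ) (∣B∣≤K : ∣ B ∣ˢ ℕ.≤ K)
  (codegree-close : ∀ u v → u ∉ B → v ∉ B → u ≢ v →
                    abs (+ 4 * Signed.codegree adj adj-sym u v - + q) ≤ + (4 ℕ.* C)) where

  open Signed adj adj-sym using (P; P-bounded; codegree)

  ι : Fin ∣ ∁ B ∣ˢ → Fin q
  ι = members (∁ B)

  adj-inside : Fin ∣ ∁ B ∣ˢ → Fin ∣ ∁ B ∣ˢ → Bool
  adj-inside k l = adj (ι k) (ι l)

  adj-inside-sym : ∀ k l → adj-inside k l ≡ adj-inside l k
  adj-inside-sym k l = adj-sym (ι k) (ι l)

  module Inside = Signed adj-inside adj-inside-sym

  through-B : Fin q → Fin q → ℤ
  through-B u v = ∑[ w < q ] (χ (lookup B) w * [ adj u w ∧ adj w v ])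

  0≤through-B : ∀ u v → 0ℤ ≤ through-B u v
  0≤through-B u v = ∑-nonneg (0≤χ*χ (lookup B) (λ w → adj u w ∧ adj w v))

  through-B≤K : ∀ u v → through-B u v ≤ + K
  through-B≤K u v = ≤-trans (∑χ*χ≤∑χˡ (lookup B) (λ w → adj u w ∧ adj w v))
                            (≤-trans (≤-reflexive (∑χ≡∣∣ B)) (+≤+ ∣B∣≤K))

  Inside-codegree : ∀ k l → Inside.codegree k l ≡ codegree (ι k) (ι l) - through-B (ι k) (ι l)
  Inside-codegree k l = begin
    ∑[ j < ∣ ∁ B ∣ˢ ] (f (ι j))                              ≡⟨ ∑-members (∁ B) f ⟩
    ∑[ w < q ] (χ (lookup (∁ B)) w * f w)                    ≡⟨ sum-cong-≗ (λ w → cong (_* f w) (χ-∁ B w)) ⟩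
    ∑[ w < q ] ((1ℤ - χ (lookup B) w) * f w)                 ≡⟨ sum-cong-≗ (λ w → spread (χ (lookup B) w) (f w)) ⟩
    ∑[ w < q ] (f w - χ (lookup B) w * f w)                  ≡⟨ ∑-distrib-- f (λ w → χ (lookup B) w * f w) ⟩
    codegree (ι k) (ι l) - ∑[ w < q ] (χ (lookup B) w * f w)
      ≡⟨ cong (λ x → codegree (ι k) (ι l) - x)
              (sum-cong-≗ (λ w → cong (χ (lookup B) w *_) (sym ([∧] (adj (ι k) w) (adj w (ι l)))))) ⟩
    codegree (ι k) (ι l) - through-B (ι k) (ι l)             ∎
    where
    open ≡-Reasoning
    spread : ∀ b x → (1ℤ - b) * x ≡ x - b * x
    spread = solve-∀
    f : Vec q
    f w = [ adj (ι k) w ] * [ adj w (ι l) ]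

  C₀ : ℕ
  C₀ = excess-bound K C

  -- Inside V ∖ B the codegree condition holds for all pairs: removing B
  -- changes every codegree by at most |B| ≤ K.
  E-inside : ∀ k l → k ≢ l → abs (Excess.E Inside.P Inside.P-sym k l) ≤ + C₀
  E-inside k l k≢l = begin
    abs (Excess.E Inside.P Inside.P-sym k l)
      ≡⟨ cong abs (trans (Inside.E≡4codegree-n k l) (cong₂ (λ x y → + 4 * x - y) (Inside-codegree k l) (∑χ∁ B))) ⟩
    abs (+ 4 * (codegree u v - R) - (+ q - + ∣ B ∣ˢ))     ≡⟨ cong abs (regroup (codegree u v) R (+ q) (+ ∣ B ∣ˢ)) ⟩
    abs ((+ 4 * codegree u v - + q) - + 4 * R - - + ∣ B ∣ˢ)
      ≤⟨ abs-−-− (+ 4 * codegree u v - + q) (+ 4 * R) (- + ∣ B ∣ˢ) ⟩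
    abs (+ 4 * codegree u v - + q) + abs (+ 4 * R) + abs (- + ∣ B ∣ˢ)
      ≤⟨ +-mono-≤ (+-mono-≤ (codegree-close u v (ι∉B k) (ι∉B l) (k≢l ∘ members-injective (∁ B))) abs-4R)
                  (≤-reflexive (cong +_ (∣-i∣≡∣i∣ (+ ∣ B ∣ˢ)))) ⟩
    + (4 ℕ.* C) + + 4 * + K + + ∣ B ∣ˢ                      ≤⟨ +-monoʳ-≤ (+ (4 ℕ.* C) + + 4 * + K) (+≤+ ∣B∣≤K) ⟩
    + (4 ℕ.* C) + + 4 * + K + + K                           ≡⟨ collect (+ (4 ℕ.* C)) (+ K) ⟩
    + (4 ℕ.* C) + + 5 * + K                                 ≡⟨ cong (λ x → + (4 ℕ.* C) + x) (pos-* 5 K) ⟨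
    + C₀                                                    ∎
    where
    open ≤-Reasoning
    regroup : ∀ c r q b → + 4 * (c - r) - (q - b) ≡ (+ 4 * c - q) - + 4 * r - - b
    regroup = solve-∀
    collect : ∀ c k → c + + 4 * k + k ≡ c + + 5 * k
    collect = solve-∀
    u v : Fin q
    u = ι k
    v = ι l
    R : ℤ
    R = through-B u v
    ι∉B : ∀ j → ι j ∉ B
    ι∉B j = x∈∁p⇒x∉p (members-∈ (∁ B) j)
    abs-4R : abs (+ 4 * R) ≤ + 4 * + K
    abs-4R = begin
      abs (+ 4 * R) ≡⟨ abs-* (+ 4) R ⟩
      + 4 * abs R   ≡⟨ cong (+ 4 *_) (0≤i⇒+∣i∣≡i (0≤through-B u v)) ⟩
      + 4 * R       ≤⟨ *-monoˡ-≤-nonNeg (+ 4) (through-B≤K u v) ⟩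
      + 4 * + K     ∎

  inside outside : Subset q → Vec q
  inside  U s = χ (lookup (∁ B)) s * χ (lookup U) s
  outside U s = (1ℤ - χ (lookup (∁ B)) s) * χ (lookup U) s

  outside≡ : ∀ U s → outside U s ≡ χ (lookup B) s * χ (lookup U) s
  outside≡ U s = cong (_* χ (lookup U) s) (1-χ∁ B s)

  0≤inside : ∀ U s → 0ℤ ≤ inside U s
  0≤inside U = 0≤χ*χ (lookup (∁ B)) (lookup U)

  0≤outside : ∀ U s → 0ℤ ≤ outside U s
  0≤outside U s = subst (0ℤ ≤_) (sym (outside≡ U s)) (0≤χ*χ (lookup B) (lookup U) s)

  ∑inside≤ : ∀ U → sum (inside U) ≤ + ∣ U ∣ˢ
  ∑inside≤ U = subst (sum (inside U) ≤_) (∑χ≡∣∣ U) (∑χ*χ≤∑χʳ (lookup (∁ B)) (lookup U))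

  ∑outside≤K : ∀ U → sum (outside U) ≤ + K
  ∑outside≤K U = begin
    sum (outside U)                              ≡⟨ sum-cong-≗ (outside≡ U) ⟩
    ∑[ s < q ] (χ (lookup B) s * χ (lookup U) s) ≤⟨ ∑χ*χ≤∑χˡ (lookup B) (lookup U) ⟩
    sum (χ (lookup B))                           ≡⟨ ∑χ≡∣∣ B ⟩
    + ∣ B ∣ˢ                                      ≤⟨ +≤+ ∣B∣≤K ⟩
    + K                                          ∎
    where open ≤-Reasoning

  ∑outside≤∣∣ : ∀ U → sum (outside U) ≤ + ∣ U ∣ˢ
  ∑outside≤∣∣ U = begin
    sum (outside U)                              ≡⟨ sum-cong-≗ (outside≡ U) ⟩
    ∑[ s < q ] (χ (lookup B) s * χ (lookup U) s) ≤⟨ ∑χ*χ≤∑χʳ (lookup B) (lookup U) ⟩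
    sum (χ (lookup U))                           ≡⟨ ∑χ≡∣∣ U ⟩
    + ∣ U ∣ˢ                                      ∎
    where open ≤-Reasoning

  module Core = Excess.Bounded Inside.P Inside.P-sym Inside.P-bounded C₀ E-inside

  c₀ : ℕ
  c₀ = discrepancy-constant K C

  module _ (S T : Subset q) where

    ∣S∣ ∣T∣ : ℤ
    ∣S∣ = + ∣ S ∣ˢ
    ∣T∣ = + ∣ T ∣ˢ

    Z° R : ℤ
    Z° = inside S ∙ (P · inside T)
    R  = inside S ∙ (P · outside T) + outside S ∙ (P · χ (lookup T))

    Z≡Z°+R : χ (lookup S) ∙ (P · χ (lookup T)) ≡ Z° + R
    Z≡Z°+R = trans (∙-·-split (χ (lookup (∁ B))) (χ (lookup S)) (χ (lookup T)) P)
                   (+-assoc Z° (inside S ∙ (P · outside T)) (outside S ∙ (P · χ (lookup T))))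

    ∣U∣≤q : ∀ U → + ∣ U ∣ˢ ≤ + q
    ∣U∣≤q U = subst (_≤ + q) (∑χ≡∣∣ U) (∑χ≤n (lookup U))

    Z°²≤ : Z° * Z° ≤ + 25 * Core.a * + q * (∣S∣ * ∣T∣)
    Z°²≤ = begin
      Z° * Z°                                  ≡⟨ cong₂ _*_ restricted restricted ⟩
      Z′ * Z′                                  ≤⟨ Core.χ∙P·χ≤ (lookup S ∘ ι) (lookup T ∘ ι) ⟩
      + 25 * Core.a * + ∣ ∁ B ∣ˢ * (sum (χ (lookup S ∘ ι)) * sum (χ (lookup T ∘ ι)))
        ≤⟨ *-mono-≤-nonNeg (0≤i*j 0≤25a (+≤+ z≤n)) (0≤i*j {∣S∣} (+≤+ z≤n) (+≤+ z≤n))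
             (*-monoˡ-≤-0≤ 0≤25a (subst (_≤ + q) (sym (∑χ∁ B)) (i-j≤i (+ q) (+ ∣ B ∣ˢ))))
             (*-mono-≤-nonNeg (∑-nonneg (0≤χ (lookup S ∘ ι))) (+≤+ z≤n) (∑inside′≤ S) (∑inside′≤ T)) ⟩
      + 25 * Core.a * + q * (∣S∣ * ∣T∣)        ∎
      where
      open ≤-Reasoning
      Z′ : ℤ
      Z′ = χ (lookup S ∘ ι) ∙ (Inside.P · χ (lookup T ∘ ι))
      restricted : Z° ≡ Z′
      restricted = ∙-·-restrict (∁ B) (χ (lookup S)) (χ (lookup T)) P
      0≤25a : 0ℤ ≤ + 25 * Core.a
      0≤25a = 0≤i*j {+ 25} (+≤+ z≤n) Core.0≤a
      ∑inside′≤ : ∀ U → sum (χ (lookup U ∘ ι)) ≤ + ∣ U ∣ˢ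
      ∑inside′≤ U = subst (_≤ + ∣ U ∣ˢ) (sym (∑-members (∁ B) (χ (lookup U)))) (∑inside≤ U)

    abs-R≤ : ∀ {Y₁ Y₂ Y₃ Y₄} → sum (inside S) ≤ Y₁ → sum (outside T) ≤ Y₂ → sum (outside S) ≤ Y₃ → ∣T∣ ≤ Y₄ →
             abs R ≤ Y₁ * Y₂ + Y₃ * Y₄
    abs-R≤ {Y₁} {Y₂} {Y₃} {Y₄} inS≤ outT≤ outS≤ ∣T∣≤ = begin
      abs R                                       ≤⟨ abs-+ (inside S ∙ (P · outside T)) (outside S ∙ (P · χ (lookup T))) ⟩
      abs (inside S ∙ (P · outside T)) + abs (outside S ∙ (P · χ (lookup T)))
        ≤⟨ +-mono-≤ (abs-bilinear≤ P P-bounded (0≤inside S) (0≤outside T))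
                    (abs-bilinear≤ P P-bounded (0≤outside S) (0≤χ (lookup T))) ⟩
      sum (inside S) * sum (outside T) + sum (outside S) * sum (χ (lookup T))
        ≤⟨ +-mono-≤ (*-mono-≤-nonNeg (∑-nonneg (0≤inside S)) (≤-trans (∑-nonneg (0≤outside T)) outT≤) inS≤ outT≤)
                    (*-mono-≤-nonNeg (∑-nonneg (0≤outside S)) (≤-trans (+≤+ z≤n) ∣T∣≤) outS≤
                                     (≤-trans (≤-reflexive (∑χ≡∣∣ T)) ∣T∣≤)) ⟩
      Y₁ * Y₂ + Y₃ * Y₄                          ∎
      where open ≤-Reasoning

    R²≤ : R * R ≤ + K * (+ q + + q) * (∣S∣ * ∣T∣ + ∣S∣ * ∣T∣)
    R²≤ = subst (_≤ + K * (+ q + + q) * (∣S∣ * ∣T∣ + ∣S∣ * ∣T∣)) (sym (i*i≡abs*abs R))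
      (*-mono-≤-nonNeg (+≤+ z≤n) (≤-trans (+≤+ z≤n) abs-R≤∣S∣∣T∣) abs-R≤Kq abs-R≤∣S∣∣T∣)
      where
      abs-R≤∣S∣∣T∣ : abs R ≤ ∣S∣ * ∣T∣ + ∣S∣ * ∣T∣
      abs-R≤∣S∣∣T∣ = abs-R≤ (∑inside≤ S) (∑outside≤∣∣ T) (∑outside≤∣∣ S) ≤-refl
      abs-R≤Kq : abs R ≤ + K * (+ q + + q)
      abs-R≤Kq = ≤-trans (abs-R≤ (≤-trans (∑inside≤ S) (∣U∣≤q S)) (∑outside≤K T) (∑outside≤K S) (∣U∣≤q T))
                         (≤-reflexive (solve₁ (+ q) (+ K)))
        where
        solve₁ : ∀ q k → q * k + k * q ≡ k * (q + q)
        solve₁ = solve-∀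

    discrepancy : χ (lookup S) ∙ (P · χ (lookup T)) * χ (lookup S) ∙ (P · χ (lookup T)) ≤ + c₀ * (+ q * (∣S∣ * ∣T∣))
    discrepancy = begin
      χ (lookup S) ∙ (P · χ (lookup T)) * χ (lookup S) ∙ (P · χ (lookup T)) ≡⟨ cong₂ _*_ Z≡Z°+R Z≡Z°+R ⟩
      (Z° + R) * (Z° + R)                                 ≤⟨ [x+y]²≤2x²+2y² Z° R ⟩
      + 2 * (Z° * Z°) + + 2 * (R * R)                     ≤⟨ +-mono-≤ (*-monoˡ-≤-nonNeg (+ 2) Z°²≤) (*-monoˡ-≤-nonNeg (+ 2) R²≤) ⟩
      + 2 * (+ 25 * Core.a * + q * (∣S∣ * ∣T∣)) + + 2 * (+ K * (+ q + + q) * (∣S∣ * ∣T∣ + ∣S∣ * ∣T∣))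
        ≡⟨ collect Core.a (+ K) (+ q) (∣S∣ * ∣T∣) ⟩
      (+ 50 * Core.a + + 8 * + K) * (+ q * (∣S∣ * ∣T∣))
        ≡⟨ cong (_* (+ q * (∣S∣ * ∣T∣))) (cong₂ _+_ (pos-* 50 (C₀ ℕ.+ 3)) (pos-* 8 K)) ⟨
      + c₀ * (+ q * (∣S∣ * ∣T∣))                          ∎
      where
      open ≤-Reasoning
      collect : ∀ a k q x → + 2 * (+ 25 * a * q * x) + + 2 * (k * (q + q) * (x + x)) ≡ (+ 50 * a + + 8 * k) * (q * x)
      collect = solve-∀

abs-square≤ : ∀ z c q y → z * z ≤ + c * (+ q * + y) → ∣ z ∣ ℕ.^ 2 ℕ.≤ 4 ℕ.* c ℕ.^ 2 ℕ.* q ℕ.* y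
abs-square≤ z c q y z²≤ = ℕ.≤-trans ∣z∣²≤
  (ℕ.≤-trans (ℕ.*-monoˡ-≤ (q ℕ.* y) (c≤4c² c)) (ℕ.≤-reflexive (sym (ℕ.*-assoc (4 ℕ.* c ℕ.^ 2) q y))))
  where
  ∣z∣²≤ : ∣ z ∣ ℕ.^ 2 ℕ.≤ c ℕ.* (q ℕ.* y)
  ∣z∣²≤ = drop‿+≤+ (subst₂ _≤_
    (trans (i*i≡abs*abs z) (trans (sym (pos-* ∣ z ∣ ∣ z ∣)) (cong (λ m → + (∣ z ∣ ℕ.* m)) (sym (ℕ.*-identityʳ ∣ z ∣)))))
    (trans (cong (+ c *_) (sym (pos-* q y))) (sym (pos-* c (q ℕ.* y)))) z²≤)
  c≤4c² : ∀ c → c ℕ.≤ 4 ℕ.* c ℕ.^ 2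
  c≤4c² zero    = z≤n
  c≤4c² (suc c) = ℕ.≤-trans (ℕ.m≤m*n (suc c) (suc c)) (ℕ.≤-trans (ℕ.m≤n*m _ 4)
                              (ℕ.≤-reflexive (cong (λ m → 4 ℕ.* (suc c ℕ.* m)) (sym (ℕ.*-identityʳ (suc c))))))

module _ (𝔽 : OddFiniteField) where
  open OddFiniteField 𝔽 using (q)

  +sumFin : ∀ {m} (g : Fin m → ℕ) → + sumFin 𝔽 g ≡ ∑[ i < m ] (+ g i)
  +sumFin {zero}  g = refl
  +sumFin {suc m} g = cong (λ x → + g Fin.zero + x) (+sumFin (g ∘ Fin.suc))

  +one? : ∀ b → + one? 𝔽 b ≡ [ b ]
  +one? true  = refl
  +one? false = refl

  adj-sym : ∀ f → (∀ u v → IsSquare 𝔽 (eval 𝔽 f u v) ⇔ IsSquare 𝔽 (eval 𝔽 f v u)) → ∀ u v → adj 𝔽 f u v ≡ adj 𝔽 f v u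
  adj-sym f square-sym u v = cong₂ (λ x y → not x ∧ y) (does-⇔ (mk⇔ sym sym) (u Fin.≟ v) (v Fin.≟ u))
                                                      (does-⇔ (square-sym u v) (any? _) (any? _))

  +A² : ∀ f f-sym u v → + A² 𝔽 f u v ≡ Signed.codegree (adj 𝔽 f) f-sym u v
  +A² f f-sym u v = trans (+sumFin (λ w → one? 𝔽 (adj 𝔽 f u w ∧ adj 𝔽 f w v)))
    (sum-cong-≗ (λ w → trans (+one? (adj 𝔽 f u w ∧ adj 𝔽 f w v)) ([∧] (adj 𝔽 f u w) (adj 𝔽 f w v))))

  +edges : ∀ f (S T : Subset q) →
    + edges 𝔽 f S T ≡ ∑[ s < q ] ∑[ t < q ] (χ (lookup S) s * (χ (lookup T) t * [ adj 𝔽 f s t ]))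
  +edges f S T = trans (+sumFin (λ s → sumFin 𝔽 (λ t → one? 𝔽 (lookup S s ∧ lookup T t ∧ adj 𝔽 f s t))))
    (sum-cong-≗ (λ s → trans (+sumFin (λ t → one? 𝔽 (lookup S s ∧ lookup T t ∧ adj 𝔽 f s t))) (sum-cong-≗ (λ t →
    trans (+one? (lookup S s ∧ lookup T t ∧ adj 𝔽 f s t))
          (trans ([∧] (lookup S s) (lookup T t ∧ adj 𝔽 f s t))
                 (cong (χ (lookup S) s *_) ([∧] (lookup T t) (adj 𝔽 f s t))))))))

  graph-discrepancy : ∀ f → (∀ u v → IsSquare 𝔽 (eval 𝔽 f u v) ⇔ IsSquare 𝔽 (eval 𝔽 f v u)) →
    ∀ (B : Subset q) (K C : ℕ) → ∣ B ∣ˢ ℕ.≤ K →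
    (∀ u v → u ∉ B → v ∉ B → u ≢ v → ∣ + (4 ℕ.* A² 𝔽 f u v) - + q ∣ ℕ.≤ 4 ℕ.* C) →
    ∀ (S T : Subset q) →
    ∣ + (2 ℕ.* edges 𝔽 f S T) - + (∣ S ∣ˢ ℕ.* ∣ T ∣ˢ) ∣ ℕ.^ 2
      ℕ.≤ 4 ℕ.* discrepancy-constant K C ℕ.^ 2 ℕ.* q ℕ.* (∣ S ∣ˢ ℕ.* ∣ T ∣ˢ)
  graph-discrepancy f square-sym B K C ∣B∣≤K close S T =
    subst (ℕ._≤ 4 ℕ.* discrepancy-constant K C ℕ.^ 2 ℕ.* q ℕ.* (∣ S ∣ˢ ℕ.* ∣ T ∣ˢ))
          (cong (ℕ._^ 2) (∣i-j∣≡∣j-i∣ (+ (∣ S ∣ˢ ℕ.* ∣ T ∣ˢ)) (+ (2 ℕ.* edges 𝔽 f S T))))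
          (abs-square≤ (+ (∣ S ∣ˢ ℕ.* ∣ T ∣ˢ) - + (2 ℕ.* edges 𝔽 f S T)) (discrepancy-constant K C) q (∣ S ∣ˢ ℕ.* ∣ T ∣ˢ)
            (subst₂ _≤_ (cong₂ _*_ (sym Z≡) (sym Z≡))
                        (cong (λ x → + discrepancy-constant K C * (+ q * x)) (sym (pos-* ∣ S ∣ˢ ∣ T ∣ˢ)))
                    (Discrepancy.discrepancy (adj 𝔽 f) f-sym B K C ∣B∣≤K close′ S T)))
    where
    open ≡-Reasoning
    f-sym : ∀ u v → adj 𝔽 f u v ≡ adj 𝔽 f v u
    f-sym = adj-sym f square-sym
    close′ : ∀ u v → u ∉ B → v ∉ B → u ≢ v → abs (+ 4 * Signed.codegree (adj 𝔽 f) f-sym u v - + q) ≤ + (4 ℕ.* C)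
    close′ u v u∉B v∉B u≢v =
      subst (λ x → abs (x - + q) ≤ + (4 ℕ.* C)) (trans (pos-* 4 (A² 𝔽 f u v)) (cong (+ 4 *_) (+A² f f-sym u v)))
            (+≤+ (close u v u∉B v∉B u≢v))
    Z≡ : + (∣ S ∣ˢ ℕ.* ∣ T ∣ˢ) - + (2 ℕ.* edges 𝔽 f S T) ≡ χ (lookup S) ∙ (Signed.P (adj 𝔽 f) f-sym · χ (lookup T))
    Z≡ = begin
      + (∣ S ∣ˢ ℕ.* ∣ T ∣ˢ) - + (2 ℕ.* edges 𝔽 f S T)
        ≡⟨ cong₂ _-_ (trans (pos-* ∣ S ∣ˢ ∣ T ∣ˢ) (sym (cong₂ _*_ (∑χ≡∣∣ S) (∑χ≡∣∣ T))))
                     (trans (pos-* 2 (edges 𝔽 f S T)) (cong (+ 2 *_) (+edges f S T))) ⟩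
      sum (χ (lookup S)) * sum (χ (lookup T)) - + 2 * ∑[ s < q ] ∑[ t < q ] (χ (lookup S) s * (χ (lookup T) t * [ adj 𝔽 f s t ]))
        ≡⟨ Signed.χ∙P·χ≡ (adj 𝔽 f) f-sym (lookup S) (lookup T) ⟨
      χ (lookup S) ∙ (Signed.P (adj 𝔽 f) f-sym · χ (lookup T)) ∎

proposition5p5 : (d : ℕ) → d ℕ.≥ 1 →
    (𝒢 : Member d → Set) →
    -- 𝒢 is infinite (equivalently, contains graphs of unboundedly many vertices)
    (∀ n → ∃ λ X → 𝒢 X × Member.order X ℕ.> n) →
    -- uniform codegree hypothesis: |B| ≤ K and |A²(u,v) - q/4| ≤ C off B
    (∃₂ λ (K C : ℕ) → ∀ X → 𝒢 X →
       Σ (Subset (Member.order X)) λ B → Data.Fin.Subset.∣ B ∣ ℕ.≤ K ×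
         (∀ (u v : Fin (Member.order X)) → u ∉ B → v ∉ B → u ≢ v →
            ℤ.∣ + (4 ℕ.* A² (Member.field𝔽 X) (Member.poly X) u v)
                           - + Member.order X ∣ ℕ.≤ 4 ℕ.* C)) →
    -- conclusion: QR(1/2), i.e. |e(S,T) - |S||T|/2| ≤ c √n √(|S||T|)
    ∃ λ (c : ℕ) → ∀ X → 𝒢 X → ∀ (S T : Subset (Member.order X)) →
      ℤ.∣ + (2 ℕ.* edges (Member.field𝔽 X) (Member.poly X) S T)
                     - + (Data.Fin.Subset.∣ S ∣ ℕ.* Data.Fin.Subset.∣ T ∣) ∣ ℕ.^ 2
        ℕ.≤ 4 ℕ.* c ℕ.^ 2 ℕ.* Member.order X ℕ.* (Data.Fin.Subset.∣ S ∣ ℕ.* Data.Fin.Subset.∣ T ∣)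
proposition5p5 _ _ 𝒢 _ (K , C , codegrees-close) = discrepancy-constant K C , λ X X∈𝒢 S T →
  let (B , ∣B∣≤K , close) = codegrees-close X X∈𝒢
  in graph-discrepancy (Member.field𝔽 X) (Member.poly X) (proj₁ (Member.adm X)) B K C ∣B∣≤K close S T
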